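{- Let $n\ge1$, $\mu\in\mathbb{N}^n$, and let $\sigma:\mathrm{dg}'(\mu)\to[n]$ be a non-attacking filling. Then $\mathrm{coinv}(\widehat{{}^\pi\sigma})=\mathrm{coinv}(\widehat\sigma)$ and $\mathrm{maj}(\widehat{{}^\pi\sigma})=\mathrm{maj}(\widehat\sigma)+\mu_n-r$, where $r=|\sigma^{ -1}(\{n\})|$.
   Context: For $\mu\in\mathbb{N}^n$, $\mathrm{dg}'(\mu)=\{(i,j)\in\mathbb{N}^2:1\le i\le n,\ 1\le j\le\mu_i\}$, $\widehat{\mathrm{dg}}(\mu)=\mathrm{dg}'(\mu)\cup\{(i,0):1\le i\le n\}$, $d((i,j))=(i,j-1)$. For $u=(i,j)\in\mathrm{dg}'(\mu)$: $l(u)=\mu_i-j$, $a(u)=|\{(i',j)\in\mathrm{dg}'(\mu):i'<i,\ \mu_{i'}\le\mu_i\}|+|\{(i',j-1)\in\widehat{\mathrm{dg}}(\mu):i'>i,\ \mu_{i'}<\mu_i\}|$. Distinct boxes attack each other if in the same row, or of the form $(i,j),(i',j-1)$ with $i<i'$. Reading order: $(i,j)$ precedes $(i',j')$ iff $j>j'$, or $j=j'$ and $i>i'$. A filling $\sigma:\mathrm{dg}'(\mu)\to[n]$ has augmented filling $\widehat\sigma$ extending it with $\widehat\sigma((i,0))=i$; non-attacking means $\widehat\sigma(u)\ne\widehat\sigma(v)$ for attacking $u,v\in\widehat{\mathrm{dg}}(\mu)$. Descents: $u\in\mathrm{dg}'(\mu)$ with $\widehat\sigma(u)>\widehat\sigma(d(u))$;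 $\mathrm{maj}(\widehat\sigma)=\sum_{u\in\mathrm{Des}(\widehat\sigma)}(l(u)+1)$. Inversions: attacking $u,v\in\widehat{\mathrm{dg}}(\mu)$, $u$ preceding $v$ in reading order, $\widehat\sigma(u)>\widehat\sigma(v)$. $\mathrm{inv}(\widehat\sigma)=|\mathrm{Inv}(\widehat\sigma)|-|\{(i,j):i<j,\ \mu_i\le\mu_j\}|-\sum_{u\in\mathrm{Des}(\widehat\sigma)}a(u)$; $\mathrm{coinv}(\widehat\sigma)=\sum_{u\in\mathrm{dg}'(\mu)}a(u)-\mathrm{inv}(\widehat\sigma)$. Cyclic shift: $\pi(\mu)=(\mu_n+1,\mu_1,\dots,\mu_{n-1})$; on boxes $\pi:\widehat{\mathrm{dg}}(\mu)\to\widehat{\mathrm{dg}}(\pi(\mu))$, $\pi((i,j))=(i+1,j)$ for $i<n$, $\pi((n,j))=(1,j+1)$; on values $\pi(k)=k+1$ for $k<n$, $\pi(n)=1$. For a filling $\sigma$ of $\mu$, ${}^\pi\sigma$ is the unique filling of $\pi(\mu)$ whose augmented filling satisfies $\widehat{{}^\pi\sigma}(\pi(u))=\pi(\widehat\sigma(u))$ for all $u\in\widehat{\mathrm{dg}}(\mu)$. -}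

module Defs where

open import Data.Nat using (ℕ; zero; suc; _+_; _∸_; _<ᵇ_; _≡ᵇ_; _≤ᵇ_; _<?_)
open import Data.Nat.DivMod using (_mod_)
open import Data.Fin using (Fin; zero; suc; toℕ; fromℕ; fromℕ<; inject₁)
open import Data.Bool using (Bool; true; false; _∧_; _∨_; not; if_then_else_)
open import Data.List using (List; []; _∷_; map; concatMap; allFin; upTo; cartesianProduct)
open import Data.List.Membership.Propositional using (_∈_)
open import Data.Product using (_×_; _,_)
open import Data.Integer using (ℤ; +_) renaming (_-_ to _-ℤ_)
open import Relation.Nullary using (yes; no; ¬_)
open import Relation.Binary.PropositionalEquality using (_≡_; _≢_)

-- Columns are indexed by Fin n: the paper's column i (1 ≤ i ≤ n) is the
-- Fin element with toℕ = i - 1.  Likewise values [n] = {1..n} are Fin n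
-- (paper value k is the Fin element with toℕ = k - 1).
-- Heights j are natural numbers exactly as in the paper (row 0 is the
-- basement row of the augmented diagram).

Box : ℕ → Set
Box n = Fin n × ℕ

-- A filling σ : dg'(μ) → [n].  The box (i , j+1) of dg'(μ) (1 ≤ j+1 ≤ μ i)
-- corresponds to the argument (j : Fin (μ i)).
Filling : ∀ {n} → (Fin n → ℕ) → Set
Filling {n} μ = (i : Fin n) → Fin (μ i) → Fin n

dg′ : ∀ {n} → (Fin n → ℕ) → List (Box n)
dg′ {n} μ = concatMap (λ i → map (λ j → (i , suc j)) (upTo (μ i))) (allFin n)

dgHat : ∀ {n} → (Fin n → ℕ) → List (Box n)
dgHat {n} μ = concatMap (λ i → map (λ j → (i , j)) (upTo (suc (μ i)))) (allFin n)

-- The augmented filling \hat σ (basement value i in box (i,0)).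
-- Outside \widehat{dg}(μ) the value is irrelevant (never used).
aug : ∀ {n} (μ : Fin n → ℕ) → Filling μ → Box n → Fin n
aug μ σ (i , zero) = i
aug μ σ (i , suc j) with j <? μ i
... | yes p = σ i (fromℕ< p)
... | no _  = i

_<F_ : ∀ {n} → Fin n → Fin n → Bool
a <F b = toℕ a <ᵇ toℕ b

_=F_ : ∀ {n} → Fin n → Fin n → Bool
a =F b = toℕ a ≡ᵇ toℕ b

count : ∀ {A : Set} → (A → Bool) → List A → ℕ
count p []       = 0
count p (x ∷ xs) = if p x then suc (count p xs) else count p xs

sumL : ∀ {A : Set} → (A → ℕ) → List A → ℕ
sumL f []       = 0
sumL f (x ∷ xs) = f x + sumL f xs

attacks : ∀ {n} → Box n → Box n → Bool
attacks (i , j) (i′ , j′) =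
  ((j ≡ᵇ j′) ∧ not (i =F i′))
  ∨ ((i <F i′) ∧ (j ≡ᵇ suc j′))
  ∨ ((i′ <F i) ∧ (j′ ≡ᵇ suc j))

precedes : ∀ {n} → Box n → Box n → Bool
precedes (i , j) (i′ , j′) = (j′ <ᵇ j) ∨ ((j ≡ᵇ j′) ∧ (i′ <F i))

NonAttacking : ∀ {n} (μ : Fin n → ℕ) → Filling μ → Set
NonAttacking μ σ = ∀ u v → u ∈ dgHat μ → v ∈ dgHat μ →
  attacks u v ≡ true → aug μ σ u ≢ aug μ σ v

down : ∀ {n} → Box n → Box n
down (i , j) = (i , j ∸ 1)

leg : ∀ {n} → (Fin n → ℕ) → Box n → ℕ
leg μ (i , j) = μ i ∸ j

arm : ∀ {n} → (Fin n → ℕ) → Box n → ℕ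
arm {n} μ (i , j) =
    count (λ i′ → (i′ <F i) ∧ (μ i′ ≤ᵇ μ i) ∧ (1 ≤ᵇ j) ∧ (j ≤ᵇ μ i′)) (allFin n)
  + count (λ i′ → (i <F i′) ∧ (μ i′ <ᵇ μ i) ∧ (j ∸ 1 ≤ᵇ μ i′)) (allFin n)

isDes : ∀ {n} (μ : Fin n → ℕ) → Filling μ → Box n → Bool
isDes μ σ u = aug μ σ (down u) <F aug μ σ u

maj : ∀ {n} (μ : Fin n → ℕ) → Filling μ → ℕ
maj μ σ = sumL (λ u → if isDes μ σ u then leg μ u + 1 else 0) (dg′ μ)

invCount : ∀ {n} (μ : Fin n → ℕ) → Filling μ → ℕ
invCount μ σ = count
  (λ { (u , v) → attacks u v ∧ precedes u v ∧ (aug μ σ v <F aug μ σ u) })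
  (cartesianProduct (dgHat μ) (dgHat μ))

coTriv : ∀ {n} → (Fin n → ℕ) → ℕ
coTriv {n} μ = count (λ { (i , j) → (i <F j) ∧ (μ i ≤ᵇ μ j) })
  (cartesianProduct (allFin n) (allFin n))

inv : ∀ {n} (μ : Fin n → ℕ) → Filling μ → ℤ
inv μ σ = (+ invCount μ σ -ℤ + coTriv μ)
          -ℤ + sumL (λ u → if isDes μ σ u then arm μ u else 0) (dg′ μ)

coinv : ∀ {n} (μ : Fin n → ℕ) → Filling μ → ℤ
coinv μ σ = + sumL (arm μ) (dg′ μ) -ℤ inv μ σ

-- Cyclic shift, for n = suc m (so n ≥ 1).  `fromℕ m` is column/value n.

πval : ∀ {m} → Fin (suc m) → Fin (suc m)
πval {m} k = suc (toℕ k) mod suc m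

πμ : ∀ {m} → (Fin (suc m) → ℕ) → Fin (suc m) → ℕ
πμ {m} μ zero    = suc (μ (fromℕ m))
πμ {m} μ (suc i) = μ (inject₁ i)

-- ^π σ : the filling of π(μ) with \hat{^πσ}(π(u)) = π(\hat σ(u)), where
-- π(i,j) = (i+1,j) for i < n and π(n,j) = (1,j+1).  Explicitly:
--   box (1,1)   = π(n,0)   gets π(n);
--   box (1,j+2) = π(n,j+1) gets π(σ(n,j+1));
--   box (i+1,j+1) = π(i,j+1) gets π(σ(i,j+1))  for i < n.
-- (Basement boxes (i+1,0) = π(i,0) automatically carry i+1 = π(i).)
πfill : ∀ {m} (μ : Fin (suc m) → ℕ) → Filling μ → Filling (πμ μ)
πfill {m} μ σ zero    zero    = πval (fromℕ m)
πfill {m} μ σ zero    (suc k) = πval (σ (fromℕ m) k)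
πfill {m} μ σ (suc i) k       = πval (σ (inject₁ i) k)

rCount : ∀ {m} (μ : Fin (suc m) → ℕ) → Filling μ → ℕ
rCount {m} μ σ = count (λ u → aug μ σ u =F fromℕ m) (dg′ μ)

{-# OPTIONS --safe #-}
module Submission where

-- Number the boxes of the augmented diagram row by row from the top, each row right to left (the
-- reading order).  π moves every box to its predecessor in this order and adds one new basement box
-- (1,0) at the very end, so it preserves the relation "u attacks v and u precedes v"; on values it
-- acts by k ↦ k + 1 (mod n), which preserves every comparison except those with n.  Hence
-- inversions and descents change only at the entries n:
--  * an inversion count changes at a box u holding n by the excess of boxes attacking u after it
--    over those attacking u before it;
--  * a descent is lost or gained exactly at the two ends of each vertical run of n's, and weighting
--    by leg + 1 or by the arm, both tail sums along the column (of 1, resp. of the excess), makes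
--    these contributions telescope.
-- Together with the arm of the new box (1,1) = π(n,0) and the new pairs counted by coTriv, the
-- contributions cancel for coinv and add up to μ_n − r for maj.

open import Defs

-- Natural-number arithmetic is opened only inside this block, so that the statement at the end can
-- use the integer operators under their usual names.
module _ where

  open import Data.Nat using (ℕ; zero; suc; _+_; _*_; _∸_; _<ᵇ_; _≡ᵇ_; _≤ᵇ_; _<?_; _<_; _≤_; s≤s; s<s; z<s)
  open import Data.Nat.Properties
  open import Data.Nat.DivMod using (_%_; m<n⇒m%n≡m; n%n≡0)
  open import Data.Nat.Tactic.RingSolver using (solve-∀)
  open import Data.Fin using (Fin; zero; suc; toℕ; fromℕ; inject₁; fromℕ<)
  open import Data.Fin.Properties using (toℕ-inject₁; ≤fromℕ; inject₁ℕ<; toℕ-fromℕ; toℕ-fromℕ<; toℕ-injective; toℕ<n)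
  open import Data.Bool using (Bool; true; false; _∧_; _∨_; not; if_then_else_; T)
  open import Data.Bool.Properties using (∧-conicalˡ; ∧-zeroʳ; ∧-identityʳ; ∧-assoc)
  open import Data.List using (List; []; _∷_; map; concatMap; allFin; upTo; cartesianProduct; _++_; applyUpTo; tabulate)
  open import Data.List.Membership.Propositional using (_∈_)
  open import Data.List.Relation.Unary.Any using (here; there)
  open import Data.Product using (_×_; _,_)
  open import Data.Empty using (⊥-elim)
  open import Relation.Nullary using (yes; no; ¬_)
  open import Relation.Binary using (tri<; tri≈; tri>)
  open import Relation.Binary.PropositionalEquality
  open import Function using (_∘_)
  open import Data.Integer using () renaming (_+_ to _+ℤ_; _-_ to _-ℤ_; +_ to pos)
  open import Data.Integer.Properties using (pos-+)
  import Data.Integer.Tactic.RingSolver as ℤ-Solver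

  ⟦_⟧ : Bool → ℕ
  ⟦ true  ⟧ = 1
  ⟦ false ⟧ = 0

  if-else-0 : ∀ b x → (if b then x else 0) ≡ ⟦ b ⟧ * x
  if-else-0 true  x = sym (+-identityʳ x)
  if-else-0 false x = refl

  count≡sumL : ∀ {A : Set} (p : A → Bool) xs → count p xs ≡ sumL (λ x → ⟦ p x ⟧) xs
  count≡sumL p []       = refl
  count≡sumL p (x ∷ xs) with p x
  ... | true  = cong suc (count≡sumL p xs)
  ... | false = count≡sumL p xs

  <ᵇ-true : ∀ {a b} → a < b → (a <ᵇ b) ≡ true
  <ᵇ-true {zero}  {suc b} _         = refl
  <ᵇ-true {suc a} {suc b} (s≤s a<b) = <ᵇ-true a<b

  <ᵇ-false : ∀ {a b} → b ≤ a → (a <ᵇ b) ≡ false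
  <ᵇ-false {a}     {zero}  _         = refl
  <ᵇ-false {suc a} {suc b} (s≤s b≤a) = <ᵇ-false b≤a

  ≤ᵇ-true : ∀ {a b} → a ≤ b → (a ≤ᵇ b) ≡ true
  ≤ᵇ-true {zero}  _   = refl
  ≤ᵇ-true {suc a} a<b = <ᵇ-true a<b

  ≤ᵇ-false : ∀ {a b} → b < a → (a ≤ᵇ b) ≡ false
  ≤ᵇ-false {suc a} (s≤s b≤a) = <ᵇ-false b≤a

  ≤ᵇ≡<ᵇ-suc : ∀ a b → (a ≤ᵇ b) ≡ (a <ᵇ suc b)
  ≤ᵇ≡<ᵇ-suc zero    b = refl
  ≤ᵇ≡<ᵇ-suc (suc a) b = refl

  ≡ᵇ-refl : ∀ a → (a ≡ᵇ a) ≡ true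
  ≡ᵇ-refl zero    = refl
  ≡ᵇ-refl (suc a) = ≡ᵇ-refl a

  ≡ᵇ-false : ∀ {a b} → a ≢ b → (a ≡ᵇ b) ≡ false
  ≡ᵇ-false {zero}  {zero}  a≢b = ⊥-elim (a≢b refl)
  ≡ᵇ-false {zero}  {suc b} _   = refl
  ≡ᵇ-false {suc a} {zero}  _   = refl
  ≡ᵇ-false {suc a} {suc b} a≢b = ≡ᵇ-false (a≢b ∘ cong suc)

  ≡ᵇ-sym : ∀ a b → (a ≡ᵇ b) ≡ (b ≡ᵇ a)
  ≡ᵇ-sym zero    zero    = refl
  ≡ᵇ-sym zero    (suc b) = refl
  ≡ᵇ-sym (suc a) zero    = refl
  ≡ᵇ-sym (suc a) (suc b) = ≡ᵇ-sym a b

  <ᵇ-suc-split : ∀ j k → ⟦ j <ᵇ k ⟧ + ⟦ k ≡ᵇ j ⟧ ≡ ⟦ j <ᵇ suc k ⟧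
  <ᵇ-suc-split zero    zero    = refl
  <ᵇ-suc-split zero    (suc k) = refl
  <ᵇ-suc-split (suc j) zero    = refl
  <ᵇ-suc-split (suc j) (suc k) = <ᵇ-suc-split j k

  ≤ᵇ-split-zero : ∀ x y → ⟦ x ≤ᵇ y ⟧ ≡ ⟦ x ≡ᵇ 0 ⟧ + ⟦ (x ≤ᵇ y) ∧ (1 ≤ᵇ x) ⟧
  ≤ᵇ-split-zero zero    y = refl
  ≤ᵇ-split-zero (suc x) y = cong ⟦_⟧ (sym (∧-identityʳ (x <ᵇ y)))

  ⟦∧⟧-peel : ∀ c p j x → (x ≡ j → p ≡ true) →
    ⟦ c ∧ p ∧ (j ≤ᵇ x) ⟧ ≡ ⟦ c ∧ (x ≡ᵇ j) ⟧ + ⟦ c ∧ p ∧ (suc j ≤ᵇ x) ⟧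
  ⟦∧⟧-peel false p j x _ = refl
  ⟦∧⟧-peel true  p j x p-at-j = peel j x p-at-j
    where
    peel : ∀ j x → (x ≡ j → p ≡ true) → ⟦ p ∧ (j ≤ᵇ x) ⟧ ≡ ⟦ x ≡ᵇ j ⟧ + ⟦ p ∧ (suc j ≤ᵇ x) ⟧
    peel zero    zero    p-at-j rewrite p-at-j refl = refl
    peel zero    (suc x) _      = refl
    peel (suc j) zero    _      = refl
    peel (suc j) (suc x) p-at-j = trans (cong (λ b → ⟦ p ∧ b ⟧) (sym (≤ᵇ≡<ᵇ-suc j x))) (peel j x (p-at-j ∘ cong suc))

  ≤ᵇ∧>ᵇ : ∀ x y → (x ≤ᵇ y) ∧ (suc y ≤ᵇ x) ≡ false
  ≤ᵇ∧>ᵇ x y with x ≤? y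
  ... | yes x≤y = trans (cong ((x ≤ᵇ y) ∧_) (≤ᵇ-false (s≤s x≤y))) (∧-zeroʳ _)
  ... | no  x≰y = cong (_∧ (suc y ≤ᵇ x)) (≤ᵇ-false (≰⇒> x≰y))

  <ᵇ∧≥ᵇ : ∀ x y → (x <ᵇ y) ∧ (y ≤ᵇ x) ≡ false
  <ᵇ∧≥ᵇ x y with x <? y
  ... | yes x<y = trans (cong ((x <ᵇ y) ∧_) (≤ᵇ-false x<y)) (∧-zeroʳ _)
  ... | no  x≮y = cong (_∧ (y ≤ᵇ x)) (<ᵇ-false (≮⇒≥ x≮y))

  ⟦∧not⟧-swap : ∀ a b → ⟦ a ∧ not b ⟧ + ⟦ b ⟧ ≡ ⟦ b ∧ not a ⟧ + ⟦ a ⟧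
  ⟦∧not⟧-swap true  true  = refl
  ⟦∧not⟧-swap true  false = refl
  ⟦∧not⟧-swap false true  = refl
  ⟦∧not⟧-swap false false = refl

  +-exchange-cancel : ∀ {a b c d x y} → a + x ≡ c + y → y + b ≡ x + d → a + b ≡ c + d
  +-exchange-cancel {a} {b} {c} {d} {x} {y} a+x≡c+y y+b≡x+d = +-cancelʳ-≡ (x + y) (a + b) (c + d) (begin
    a + b + (x + y)     ≡⟨ regroup a b x y ⟩
    (a + x) + (y + b)   ≡⟨ cong₂ _+_ a+x≡c+y y+b≡x+d ⟩
    (c + y) + (x + d)   ≡⟨ regroup′ c y x d ⟩
    c + d + (x + y)     ∎)
    where
    open ≡-Reasoning
    regroup : ∀ a b x y → a + b + (x + y) ≡ (a + x) + (y + b)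
    regroup = solve-∀
    regroup′ : ∀ c y x d → (c + y) + (x + d) ≡ c + d + (x + y)
    regroup′ = solve-∀

  ∸-suc-step : ∀ a j → j < a → a ∸ j ≡ suc (a ∸ suc j)
  ∸-suc-step (suc a) zero    _         = refl
  ∸-suc-step (suc a) (suc j) (s≤s j<a) = ∸-suc-step a j j<a

  module _ {A : Set} where

    sumL-++ : ∀ (f : A → ℕ) xs ys → sumL f (xs ++ ys) ≡ sumL f xs + sumL f ys
    sumL-++ f []       ys = refl
    sumL-++ f (x ∷ xs) ys = trans (cong (f x +_) (sumL-++ f xs ys)) (sym (+-assoc (f x) _ _))

    sumL-cong : ∀ {f g : A → ℕ} xs → (∀ x → f x ≡ g x) → sumL f xs ≡ sumL g xs
    sumL-cong []       f≗g = refl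
    sumL-cong (x ∷ xs) f≗g = cong₂ _+_ (f≗g x) (sumL-cong xs f≗g)

    sumL-cong-∈ : ∀ {f g : A → ℕ} xs → (∀ x → x ∈ xs → f x ≡ g x) → sumL f xs ≡ sumL g xs
    sumL-cong-∈ []       f≗g = refl
    sumL-cong-∈ (x ∷ xs) f≗g = cong₂ _+_ (f≗g x (here refl)) (sumL-cong-∈ xs (λ y y∈ → f≗g y (there y∈)))

    sumL-zero : ∀ (xs : List A) → sumL (λ _ → 0) xs ≡ 0
    sumL-zero []       = refl
    sumL-zero (x ∷ xs) = sumL-zero xs

    sumL-distrib-+ : ∀ (f g : A → ℕ) xs → sumL (λ x → f x + g x) xs ≡ sumL f xs + sumL g xs
    sumL-distrib-+ f g []       = refl
    sumL-distrib-+ f g (x ∷ xs) = trans (cong (f x + g x +_) (sumL-distrib-+ f g xs)) (swap (f x) (g x) _ _)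
      where
      swap : ∀ a b c d → a + b + (c + d) ≡ a + c + (b + d)
      swap = solve-∀

  sumL-map : ∀ {A B : Set} (f : B → ℕ) (g : A → B) xs → sumL f (map g xs) ≡ sumL (f ∘ g) xs
  sumL-map f g []       = refl
  sumL-map f g (x ∷ xs) = cong (f (g x) +_) (sumL-map f g xs)

  module _ {A B : Set} where

    sumL-concatMap : ∀ (f : B → ℕ) (g : A → List B) xs →
      sumL f (concatMap g xs) ≡ sumL (λ x → sumL f (g x)) xs
    sumL-concatMap f g []       = refl
    sumL-concatMap f g (x ∷ xs) =
      trans (sumL-++ f (g x) (concatMap g xs)) (cong (sumL f (g x) +_) (sumL-concatMap f g xs))

    sumL-cartesianProduct : ∀ (f : A × B → ℕ) xs ys →
      sumL f (cartesianProduct xs ys) ≡ sumL (λ x → sumL (λ y → f (x , y)) ys) xs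
    sumL-cartesianProduct f []       ys = refl
    sumL-cartesianProduct f (x ∷ xs) ys =
      trans (sumL-++ f (map (x ,_) ys) _) (cong₂ _+_ (sumL-map f (x ,_) ys) (sumL-cartesianProduct f xs ys))

    sumL-comm : ∀ (F : A → B → ℕ) xs ys →
      sumL (λ x → sumL (F x) ys) xs ≡ sumL (λ y → sumL (λ x → F x y) xs) ys
    sumL-comm F []       ys = sym (sumL-zero ys)
    sumL-comm F (x ∷ xs) ys =
      trans (cong (sumL (F x) ys +_) (sumL-comm F xs ys))
            (sym (sumL-distrib-+ (F x) (λ y → sumL (λ x′ → F x′ y) xs) ys))

  sumL² : ∀ {A : Set} → (A → A → ℕ) → List A → ℕ
  sumL² F xs = sumL (λ x → sumL (F x) xs) xs

  sumL²-distrib-+ : ∀ {A : Set} (F G : A → A → ℕ) xs → sumL² (λ x y → F x y + G x y) xs ≡ sumL² F xs + sumL² G xs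
  sumL²-distrib-+ F G xs =
    trans (sumL-cong xs (λ x → sumL-distrib-+ (F x) (G x) xs)) (sumL-distrib-+ (λ x → sumL (F x) xs) (λ x → sumL (G x) xs) xs)

  sumL²-cong-∈ : ∀ {A : Set} {F G : A → A → ℕ} xs → (∀ x y → x ∈ xs → y ∈ xs → F x y ≡ G x y) →
    sumL² F xs ≡ sumL² G xs
  sumL²-cong-∈ xs F≗G = sumL-cong-∈ xs (λ x x∈ → sumL-cong-∈ xs (λ y y∈ → F≗G x y x∈ y∈))

  sumL-tabulate : ∀ {A : Set} n (f : A → ℕ) (g : Fin n → A) →
    sumL f (tabulate g) ≡ sumL (f ∘ g) (allFin n)
  sumL-tabulate zero    f g = refl
  sumL-tabulate (suc n) f g = cong (f (g zero) +_)
    (trans (sumL-tabulate n f (g ∘ suc)) (sym (sumL-tabulate n (f ∘ g) suc)))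

  sumL-allFin-suc : ∀ n (f : Fin (suc n) → ℕ) →
    sumL f (allFin (suc n)) ≡ f zero + sumL (f ∘ suc) (allFin n)
  sumL-allFin-suc n f = cong (f zero +_) (sumL-tabulate n f suc)

  sumL-allFin-last : ∀ n (f : Fin (suc n) → ℕ) →
    sumL f (allFin (suc n)) ≡ sumL (f ∘ inject₁) (allFin n) + f (fromℕ n)
  sumL-allFin-last zero    f = +-comm (f zero) 0
  sumL-allFin-last (suc n) f = begin
    sumL f (allFin (suc (suc n)))                                          ≡⟨ sumL-allFin-suc (suc n) f ⟩
    f zero + sumL (f ∘ suc) (allFin (suc n))                               ≡⟨ cong (f zero +_) (sumL-allFin-last n (f ∘ suc)) ⟩
    f zero + (sumL (f ∘ suc ∘ inject₁) (allFin n) + f (fromℕ (suc n)))     ≡⟨ sym (+-assoc (f zero) _ _) ⟩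
    f zero + sumL (f ∘ suc ∘ inject₁) (allFin n) + f (fromℕ (suc n))       ≡⟨ cong (_+ f (fromℕ (suc n))) (sym (sumL-allFin-suc n (f ∘ inject₁))) ⟩
    sumL (f ∘ inject₁) (allFin (suc n)) + f (fromℕ (suc n))                ∎
    where open ≡-Reasoning

  sumL-allFin-1 : ∀ n → sumL (λ (_ : Fin n) → 1) (allFin n) ≡ n
  sumL-allFin-1 zero    = refl
  sumL-allFin-1 (suc n) = trans (sumL-allFin-suc n (λ _ → 1)) (cong suc (sumL-allFin-1 n))

  sumL-allFin-rotate : ∀ m {f g : Fin (suc m) → ℕ} → f zero ≡ g (fromℕ m) → (∀ b → f (suc b) ≡ g (inject₁ b)) →
    sumL f (allFin (suc m)) ≡ sumL g (allFin (suc m))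
  sumL-allFin-rotate m {f} {g} f0≡ fs≡ = begin
    sumL f (allFin (suc m))                           ≡⟨ sumL-allFin-suc m f ⟩
    f zero + sumL (f ∘ suc) (allFin m)                ≡⟨ +-comm (f zero) _ ⟩
    sumL (f ∘ suc) (allFin m) + f zero                ≡⟨ cong₂ _+_ (sumL-cong (allFin m) fs≡) f0≡ ⟩
    sumL (g ∘ inject₁) (allFin m) + g (fromℕ m)       ≡⟨ sumL-allFin-last m g ⟨
    sumL g (allFin (suc m))                           ∎
    where open ≡-Reasoning

  sumL-applyUpTo : ∀ {A : Set} k (f : A → ℕ) (g : ℕ → A) →
    sumL f (applyUpTo g k) ≡ sumL (f ∘ g) (upTo k)
  sumL-applyUpTo zero    f g = refl
  sumL-applyUpTo (suc k) f g = cong (f (g 0) +_)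
    (trans (sumL-applyUpTo k f (g ∘ suc)) (sym (sumL-applyUpTo k (f ∘ g) suc)))

  sumL-upTo-suc : ∀ k (f : ℕ → ℕ) → sumL f (upTo (suc k)) ≡ f 0 + sumL (f ∘ suc) (upTo k)
  sumL-upTo-suc k f = cong (f 0 +_) (sumL-applyUpTo k f suc)

  sumL-upTo-≡ᵇ : ∀ k c → sumL (λ j → ⟦ j ≡ᵇ c ⟧) (upTo k) ≡ ⟦ c <ᵇ k ⟧
  sumL-upTo-≡ᵇ zero    c       = refl
  sumL-upTo-≡ᵇ (suc k) zero    = trans (sumL-upTo-suc k (λ j → ⟦ j ≡ᵇ 0 ⟧)) (cong suc (sumL-zero (upTo k)))
  sumL-upTo-≡ᵇ (suc k) (suc c) = trans (sumL-upTo-suc k (λ j → ⟦ j ≡ᵇ suc c ⟧)) (sumL-upTo-≡ᵇ k c)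

  sumL-upTo-single : ∀ {f : ℕ → Bool} k c → (∀ j → f j ≡ (j ≡ᵇ c)) →
    sumL (λ j → ⟦ f j ⟧) (upTo k) ≡ ⟦ c <ᵇ k ⟧
  sumL-upTo-single k c f≡ = trans (sumL-cong (upTo k) (λ j → cong ⟦_⟧ (f≡ j))) (sumL-upTo-≡ᵇ k c)

  colSum : ∀ {n} → (Fin n → ℕ) → (Fin n → ℕ → ℕ) → ℕ
  colSum {n} len F = sumL (λ i → sumL (F i) (upTo (len i))) (allFin n)

  colSum-cong : ∀ {n} (len : Fin n → ℕ) {F G : Fin n → ℕ → ℕ} →
    (∀ i j → F i j ≡ G i j) → colSum len F ≡ colSum len G
  colSum-cong {n} len F≗G = sumL-cong (allFin n) (λ i → sumL-cong (upTo (len i)) (F≗G i))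

  colSum-distrib-+ : ∀ {n} (len : Fin n → ℕ) (F G : Fin n → ℕ → ℕ) →
    colSum len (λ i j → F i j + G i j) ≡ colSum len F + colSum len G
  colSum-distrib-+ {n} len F G =
    trans (sumL-cong (allFin n) (λ i → sumL-distrib-+ (F i) (G i) (upTo (len i))))
          (sumL-distrib-+ (λ i → sumL (F i) (upTo (len i))) (λ i → sumL (G i) (upTo (len i))) (allFin n))

  sumL-dgHat : ∀ {n} (μ : Fin n → ℕ) (F : Box n → ℕ) →
    sumL F (dgHat μ) ≡ colSum (suc ∘ μ) (λ i j → F (i , j))
  sumL-dgHat {n} μ F = trans (sumL-concatMap F _ (allFin n))
    (sumL-cong (allFin n) (λ i → sumL-map F (i ,_) (upTo (suc (μ i)))))

  sumL-dg′ : ∀ {n} (μ : Fin n → ℕ) (F : Box n → ℕ) →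
    sumL F (dg′ μ) ≡ colSum μ (λ i j → F (i , suc j))
  sumL-dg′ {n} μ F = trans (sumL-concatMap F _ (allFin n))
    (sumL-cong (allFin n) (λ i → sumL-map F (λ j → (i , suc j)) (upTo (μ i))))

  -- The cyclic shift on boxes and values

  data LastView {m : ℕ} : Fin (suc m) → Set where
    inj  : (a : Fin m) → LastView (inject₁ a)
    last : LastView (fromℕ m)

  lastView : ∀ {m} (i : Fin (suc m)) → LastView i
  lastView {zero}  zero    = last
  lastView {suc m} zero    = inj zero
  lastView {suc m} (suc i) with lastView i
  ... | inj a = inj (suc a)
  ... | last  = last

  lastView-inject₁ : ∀ {m} (a : Fin m) → lastView (inject₁ a) ≡ inj a
  lastView-inject₁ {suc m} zero    = refl
  lastView-inject₁ {suc m} (suc a) rewrite lastView-inject₁ a = refl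

  lastView-fromℕ : ∀ m → lastView (fromℕ m) ≡ last
  lastView-fromℕ zero    = refl
  lastView-fromℕ (suc m) rewrite lastView-fromℕ m = refl

  πboxᵛ : ∀ {m} {i : Fin (suc m)} → LastView i → ℕ → Box (suc m)
  πboxᵛ (inj a) j = (suc a , j)
  πboxᵛ last    j = (zero , suc j)

  πbox : ∀ {m} → Box (suc m) → Box (suc m)
  πbox (i , j) = πboxᵛ (lastView i) j

  πbox-inject₁ : ∀ {m} (a : Fin m) j → πbox (inject₁ a , j) ≡ (suc a , j)
  πbox-inject₁ a j rewrite lastView-inject₁ a = refl

  πbox-fromℕ : ∀ m j → πbox (fromℕ m , j) ≡ (zero , suc j)
  πbox-fromℕ m j rewrite lastView-fromℕ m = refl

  up : ∀ {n} → Box n → Box n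
  up (i , j) = (i , suc j)

  πbox-up : ∀ {m} (i : Fin (suc m)) j → πbox (i , suc j) ≡ up (πbox (i , j))
  πbox-up i j with lastView i
  ... | inj a = refl
  ... | last  = refl

  down-πbox-up : ∀ {m} (i : Fin (suc m)) j → down (πbox (i , suc j)) ≡ πbox (i , j)
  down-πbox-up i j with lastView i
  ... | inj a = refl
  ... | last  = refl

  -- Column 1 of π(μ) is the last column of μ raised by one, on top of a new basement box.
  colSum-πμ : ∀ {m} (len : Fin (suc m) → ℕ) (F : Box (suc m) → ℕ) →
    colSum (πμ len) (λ i j → F (i , j)) ≡ F (zero , 0) + colSum len (λ i j → F (πbox (i , j)))
  colSum-πμ {m} len F = begin
    colSum (πμ len) (λ i j → F (i , j))                         ≡⟨ sumL-allFin-suc m _ ⟩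
    sumL (λ j → F (zero , j)) (upTo (suc (len (fromℕ m)))) + S   ≡⟨ cong (_+ S) (sumL-upTo-suc (len (fromℕ m)) (λ j → F (zero , j))) ⟩
    F (zero , 0) + Sℓ + S                                        ≡⟨ regroup (F (zero , 0)) Sℓ S ⟩
    F (zero , 0) + (S + Sℓ)                                      ≡⟨ cong (F (zero , 0) +_) (cong₂ _+_ S≡ Sℓ≡) ⟩
    F (zero , 0) + (sumL (λ a → C (inject₁ a)) (allFin m) + C (fromℕ m))
                                                                 ≡⟨ cong (F (zero , 0) +_) (sym (sumL-allFin-last m C)) ⟩
    F (zero , 0) + colSum len (λ i j → F (πbox (i , j)))         ∎
    where
    open ≡-Reasoning
    C : Fin (suc m) → ℕ
    C i = sumL (λ j → F (πbox (i , j))) (upTo (len i))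
    S Sℓ : ℕ
    S  = sumL (λ a → sumL (λ j → F (suc a , j)) (upTo (len (inject₁ a)))) (allFin m)
    Sℓ = sumL (λ j → F (zero , suc j)) (upTo (len (fromℕ m)))
    regroup : ∀ a b c → a + b + c ≡ a + (c + b)
    regroup = solve-∀
    S≡ : S ≡ sumL (λ a → C (inject₁ a)) (allFin m)
    S≡ = sumL-cong (allFin m) (λ a → sumL-cong (upTo (len (inject₁ a))) (λ j → cong F (sym (πbox-inject₁ a j))))
    Sℓ≡ : Sℓ ≡ C (fromℕ m)
    Sℓ≡ = sumL-cong (upTo (len (fromℕ m))) (λ j → cong F (sym (πbox-fromℕ m j)))

  sumL-dgHat-πμ : ∀ {m} (μ : Fin (suc m) → ℕ) (F : Box (suc m) → ℕ) →
    sumL F (dgHat (πμ μ)) ≡ F (zero , 0) + sumL (F ∘ πbox) (dgHat μ)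
  sumL-dgHat-πμ {m} μ F = begin
    sumL F (dgHat (πμ μ))                                  ≡⟨ sumL-dgHat (πμ μ) F ⟩
    colSum (suc ∘ πμ μ) (λ i j → F (i , j))                ≡⟨ sumL-cong (allFin (suc m)) suc∘πμ ⟩
    colSum (πμ (suc ∘ μ)) (λ i j → F (i , j))              ≡⟨ colSum-πμ (suc ∘ μ) F ⟩
    F (zero , 0) + colSum (suc ∘ μ) (λ i j → F (πbox (i , j)))
                                                           ≡⟨ cong (F (zero , 0) +_) (sym (sumL-dgHat μ (F ∘ πbox))) ⟩
    F (zero , 0) + sumL (F ∘ πbox) (dgHat μ)               ∎
    where
    open ≡-Reasoning
    suc∘πμ : ∀ i → sumL (λ j → F (i , j)) (upTo (suc (πμ μ i))) ≡ sumL (λ j → F (i , j)) (upTo (πμ (suc ∘ μ) i))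
    suc∘πμ zero    = refl
    suc∘πμ (suc a) = refl

  sumL-dg′-πμ : ∀ {m} (μ : Fin (suc m) → ℕ) (F : Box (suc m) → ℕ) →
    sumL F (dg′ (πμ μ)) ≡ F (zero , 1) + sumL (F ∘ πbox) (dg′ μ)
  sumL-dg′-πμ μ F = begin
    sumL F (dg′ (πμ μ))                                    ≡⟨ sumL-dg′ (πμ μ) F ⟩
    colSum (πμ μ) (λ i j → F (up (i , j)))                 ≡⟨ colSum-πμ μ (F ∘ up) ⟩
    F (zero , 1) + colSum μ (λ i j → F (up (πbox (i , j))))
                      ≡⟨ cong (F (zero , 1) +_) (colSum-cong μ (λ i j → cong F (sym (πbox-up i j)))) ⟩
    F (zero , 1) + colSum μ (λ i j → F (πbox (i , suc j))) ≡⟨ cong (F (zero , 1) +_) (sym (sumL-dg′ μ (F ∘ πbox))) ⟩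
    F (zero , 1) + sumL (F ∘ πbox) (dg′ μ)                 ∎
    where open ≡-Reasoning

  πval-inject₁ : ∀ {m} (a : Fin m) → πval (inject₁ a) ≡ suc a
  πval-inject₁ {m} a = toℕ-injective (begin
    toℕ (πval (inject₁ a))      ≡⟨ toℕ-fromℕ< _ ⟩
    suc (toℕ (inject₁ a)) % suc m ≡⟨ cong (λ x → suc x % suc m) (toℕ-inject₁ a) ⟩
    suc (toℕ a) % suc m         ≡⟨ m<n⇒m%n≡m (s<s (toℕ<n a)) ⟩
    suc (toℕ a)                 ∎)
    where open ≡-Reasoning

  πval-fromℕ : ∀ m → πval (fromℕ m) ≡ zero
  πval-fromℕ m = toℕ-injective (begin
    toℕ (πval (fromℕ m))        ≡⟨ toℕ-fromℕ< _ ⟩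
    suc (toℕ (fromℕ m)) % suc m ≡⟨ cong (λ x → suc x % suc m) (toℕ-fromℕ m) ⟩
    suc m % suc m               ≡⟨ n%n≡0 (suc m) ⟩
    0                           ∎)
    where open ≡-Reasoning

  isLast : ∀ {m} → Fin (suc m) → Bool
  isLast {m} x = x =F fromℕ m

  isLast-inject₁ : ∀ {m} (a : Fin m) → isLast (inject₁ a) ≡ false
  isLast-inject₁ {m} a rewrite toℕ-inject₁ a | toℕ-fromℕ m = ≡ᵇ-false (<⇒≢ (toℕ<n a))

  isLast-fromℕ : ∀ m → isLast (fromℕ m) ≡ true
  isLast-fromℕ m = ≡ᵇ-refl (toℕ (fromℕ m))

  isLast⇒≡fromℕ : ∀ {m} (a : Fin (suc m)) → isLast a ≡ true → a ≡ fromℕ m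
  isLast⇒≡fromℕ {m} a isLast-a = toℕ-injective (≡ᵇ⇒≡ _ _ (subst T (sym isLast-a) _))

  inject₁<ᵇfromℕ : ∀ {m} (a : Fin m) → (toℕ a <ᵇ m) ≡ true
  inject₁<ᵇfromℕ a = <ᵇ-true (toℕ<n a)

  fromℕ<ᵇinject₁ : ∀ {m} (a : Fin m) → (m <ᵇ toℕ a) ≡ false
  fromℕ<ᵇinject₁ a = <ᵇ-false (<⇒≤ (toℕ<n a))

  sumL-allFin-isLast : ∀ {m} (g : Fin (suc m) → ℕ) → sumL (λ i → ⟦ isLast i ⟧ * g i) (allFin (suc m)) ≡ g (fromℕ m)
  sumL-allFin-isLast {m} g = begin
    sumL (λ i → ⟦ isLast i ⟧ * g i) (allFin (suc m))
      ≡⟨ sumL-allFin-last m _ ⟩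
    sumL (λ a → ⟦ isLast (inject₁ a) ⟧ * g (inject₁ a)) (allFin m) + ⟦ isLast (fromℕ m) ⟧ * g (fromℕ m)
      ≡⟨ cong₂ _+_ others (cong (λ b → ⟦ b ⟧ * g (fromℕ m)) (isLast-fromℕ m)) ⟩
    1 * g (fromℕ m)
      ≡⟨ *-identityˡ _ ⟩
    g (fromℕ m) ∎
    where
    open ≡-Reasoning
    others : sumL (λ a → ⟦ isLast (inject₁ a) ⟧ * g (inject₁ a)) (allFin m) ≡ 0
    others = trans (sumL-cong (allFin m) (λ a → cong (λ b → ⟦ b ⟧ * g (inject₁ a)) (isLast-inject₁ a))) (sumL-zero (allFin m))

  -- The cyclic shift k ↦ k + 1 of values preserves every comparison not involving n, and reverses
  -- those that do.
  πval-<F : ∀ {m} (a b : Fin (suc m)) →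
    ⟦ πval b <F πval a ⟧ + ⟦ isLast a ∧ not (isLast b) ⟧ ≡ ⟦ b <F a ⟧ + ⟦ isLast b ∧ not (isLast a) ⟧
  πval-<F {m} a b with lastView a | lastView b
  ... | inj a′ | inj b′ rewrite πval-inject₁ a′ | πval-inject₁ b′ | isLast-inject₁ a′ | isLast-inject₁ b′
                              | toℕ-inject₁ a′ | toℕ-inject₁ b′ = refl
  ... | inj a′ | last   rewrite πval-inject₁ a′ | πval-fromℕ m | isLast-inject₁ a′ | isLast-fromℕ m
                              | toℕ-inject₁ a′ | toℕ-fromℕ m | fromℕ<ᵇinject₁ a′ = refl
  ... | last   | inj b′ rewrite πval-inject₁ b′ | πval-fromℕ m | isLast-inject₁ b′ | isLast-fromℕ m
                              | toℕ-inject₁ b′ | toℕ-fromℕ m | inject₁<ᵇfromℕ b′ = refl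
  ... | last   | last   rewrite πval-fromℕ m | isLast-fromℕ m | toℕ-fromℕ m | <ᵇ-false (≤-refl {m}) = refl

  πval-<F-distinct : ∀ {m} (a b : Fin (suc m)) → a ≢ b →
    ⟦ πval b <F πval a ⟧ + ⟦ isLast a ⟧ ≡ ⟦ b <F a ⟧ + ⟦ isLast b ⟧
  πval-<F-distinct a b a≢b with isLast a in last-a | isLast b in last-b | πval-<F a b
  ... | true  | true  | _     = ⊥-elim (a≢b (trans (isLast⇒≡fromℕ a last-a) (sym (isLast⇒≡fromℕ b last-b))))
  ... | true  | false | shift = shift
  ... | false | true  | shift = shift
  ... | false | false | shift = shift

  module _ {n} (μ : Fin n → ℕ) (σ : Filling μ) where

    aug-inside : ∀ i j (j<μi : j < μ i) → aug μ σ (i , suc j) ≡ σ i (fromℕ< j<μi)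
    aug-inside i j j<μi with j <? μ i
    ... | yes _   = refl
    ... | no  j≮μi = ⊥-elim (j≮μi j<μi)

    aug-outside : ∀ i j → ¬ (j < μ i) → aug μ σ (i , suc j) ≡ i
    aug-outside i j j≮μi with j <? μ i
    ... | yes j<μi = ⊥-elim (j≮μi j<μi)
    ... | no  _    = refl

  aug-πfill : ∀ {m} (μ : Fin (suc m) → ℕ) (σ : Filling μ) u →
    aug (πμ μ) (πfill μ σ) (πbox u) ≡ πval (aug μ σ u)
  aug-πfill {m} μ σ (i , j) with lastView i
  aug-πfill μ σ (_ , zero)  | inj a = sym (πval-inject₁ a)
  aug-πfill μ σ (_ , suc j) | inj a with j <? μ (inject₁ a)
  ... | yes _ = refl
  ... | no  _ = sym (πval-inject₁ a)
  aug-πfill {m} μ σ (_ , zero)  | last = refl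
  aug-πfill {m} μ σ (_ , suc j) | last with j <? μ (fromℕ m)
  ... | yes j<μℓ = aug-inside (πμ μ) (πfill μ σ) zero (suc j) (s<s j<μℓ)
  ... | no  j≮μℓ = trans (aug-outside (πμ μ) (πfill μ σ) zero (suc j) (j≮μℓ ∘ ≤-pred)) (sym (πval-fromℕ m))

  attPrec : ∀ {n} → Box n → Box n → Bool
  attPrec u v = attacks u v ∧ precedes u v

  -- attPrec (i , j) (i′ , j′) unfolds to attPrecᵇ (i <F i′) (i =F i′) (i′ <F i) j j′.
  attPrecᵇ : Bool → Bool → Bool → ℕ → ℕ → Bool
  attPrecᵇ lt eq gt j j′ =
    (((j ≡ᵇ j′) ∧ not eq) ∨ (lt ∧ (j ≡ᵇ suc j′)) ∨ (gt ∧ (j′ ≡ᵇ suc j))) ∧ ((j′ <ᵇ j) ∨ ((j ≡ᵇ j′) ∧ gt))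

  attPrecᵇ-< : ∀ j j′ → attPrecᵇ true false false j j′ ≡ (j ≡ᵇ suc j′)
  attPrecᵇ-< (suc j)       (suc j′) = attPrecᵇ-< j j′
  attPrecᵇ-< zero          zero     = refl
  attPrecᵇ-< zero          (suc j′) = refl
  attPrecᵇ-< (suc zero)    zero     = refl
  attPrecᵇ-< (suc (suc j)) zero     = refl

  attPrecᵇ-≡ : ∀ j j′ → attPrecᵇ false true false j j′ ≡ false
  attPrecᵇ-≡ (suc j) (suc j′) = attPrecᵇ-≡ j j′
  attPrecᵇ-≡ zero    zero     = refl
  attPrecᵇ-≡ zero    (suc j′) = refl
  attPrecᵇ-≡ (suc j) zero     = refl

  attPrecᵇ-> : ∀ j j′ → attPrecᵇ false false true j j′ ≡ (j ≡ᵇ j′)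
  attPrecᵇ-> (suc j) (suc j′)       = attPrecᵇ-> j j′
  attPrecᵇ-> zero    zero           = refl
  attPrecᵇ-> zero    (suc zero)     = refl
  attPrecᵇ-> zero    (suc (suc j′)) = refl
  attPrecᵇ-> (suc j) zero           = refl

  module _ {n} {i i′ : Fin n} where

    attPrec-< : toℕ i < toℕ i′ → ∀ j j′ → attPrec (i , j) (i′ , j′) ≡ (j ≡ᵇ suc j′)
    attPrec-< i<i′ j j′ rewrite <ᵇ-true i<i′ | <ᵇ-false (<⇒≤ i<i′) | ≡ᵇ-false (<⇒≢ i<i′) = attPrecᵇ-< j j′

    attPrec-≡ : toℕ i ≡ toℕ i′ → ∀ j j′ → attPrec (i , j) (i′ , j′) ≡ false
    attPrec-≡ i≡i′ j j′ rewrite i≡i′ | ≡ᵇ-refl (toℕ i′) | <ᵇ-false (≤-refl {toℕ i′}) = attPrecᵇ-≡ j j′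

    attPrec-> : toℕ i′ < toℕ i → ∀ j j′ → attPrec (i , j) (i′ , j′) ≡ (j ≡ᵇ j′)
    attPrec-> i′<i j j′ rewrite <ᵇ-true i′<i | <ᵇ-false (<⇒≤ i′<i) | ≡ᵇ-false (>⇒≢ i′<i) = attPrecᵇ-> j j′

  inject₁<fromℕ : ∀ {m} (a : Fin m) → toℕ (inject₁ a) < toℕ (fromℕ m)
  inject₁<fromℕ {m} a = subst (toℕ (inject₁ a) <_) (sym (toℕ-fromℕ m)) (inject₁ℕ< a)

  -- π moves every box to its predecessor in the reading order, so it preserves attPrec.
  attPrec-πbox : ∀ {m} (u v : Box (suc m)) → attPrec (πbox u) (πbox v) ≡ attPrec u v
  attPrec-πbox {m} (i , j) (i′ , j′) with lastView i | lastView i′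
  ... | inj a | inj b rewrite toℕ-inject₁ a | toℕ-inject₁ b = refl
  ... | inj a | last  = trans (attPrec-> {i = suc a} {i′ = zero} z<s j (suc j′)) (sym (attPrec-< (inject₁<fromℕ a) j j′))
  ... | last  | inj b = trans (attPrec-< {i = zero} {i′ = suc b} z<s (suc j) j′) (sym (attPrec-> (inject₁<fromℕ b) j j′))
  ... | last  | last  = trans (attPrec-≡ {suc m} {i = zero} {i′ = zero} refl (suc j) (suc j′))
                              (sym (attPrec-≡ {i = fromℕ m} refl j j′))

  -- (zero , 0) is the basement box of π(μ) that is not of the form π u; it comes last in reading order.
  attPrec-corner : ∀ {n} (v : Box (suc n)) → attPrec (zero , 0) v ≡ false
  attPrec-corner (i′ , j′) rewrite ∧-zeroʳ (0 ≡ᵇ j′) = ∧-zeroʳ _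

  excessAt : ∀ {n} (μ : Fin n → ℕ) → Box n → Fin n → ℕ
  excessAt μ (i , j) i′ = ⟦ (i′ <F i) ∧ (μ i′ ≡ᵇ j) ⟧ + ⟦ (i <F i′) ∧ (suc (μ i′) ≡ᵇ j) ⟧

  -- By attPrec-balance and arm-step below, excess μ u is both
  -- #{v | attPrec u v} − #{v | attPrec v u} and arm μ u − arm μ (up u).
  excess : ∀ {n} (μ : Fin n → ℕ) → Box n → ℕ
  excess {n} μ u = sumL (excessAt μ u) (allFin n)

  module _ {n} (μ : Fin n → ℕ) {i i′ : Fin n} (j : ℕ) where

    excessAt-< : toℕ i < toℕ i′ → excessAt μ (i , j) i′ ≡ ⟦ suc (μ i′) ≡ᵇ j ⟧
    excessAt-< i<i′ rewrite <ᵇ-true i<i′ | <ᵇ-false (<⇒≤ i<i′) = refl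

    excessAt-≡ : toℕ i ≡ toℕ i′ → excessAt μ (i , j) i′ ≡ 0
    excessAt-≡ i≡i′ rewrite i≡i′ | <ᵇ-false (≤-refl {toℕ i′}) = refl

    excessAt-> : toℕ i′ < toℕ i → excessAt μ (i , j) i′ ≡ ⟦ μ i′ ≡ᵇ j ⟧
    excessAt-> i′<i rewrite <ᵇ-true i′<i | <ᵇ-false (<⇒≤ i′<i) = +-identityʳ _

  attPrec-balance-column : ∀ {n} (μ : Fin n → ℕ) (i : Fin n) j →
    (j ≡ 0 → ∀ (i′ : Fin n) → toℕ i′ ≤ toℕ i) → ∀ i′ →
    sumL (λ j′ → ⟦ attPrec (i′ , j′) (i , j) ⟧) (upTo (suc (μ i′))) + excessAt μ (i , j) i′
    ≡ sumL (λ j′ → ⟦ attPrec (i , j) (i′ , j′) ⟧) (upTo (suc (μ i′)))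
  attPrec-balance-column μ i j basement⇒rightmost i′ with <-cmp (toℕ i′) (toℕ i)
  ... | tri< i′<i _ _ = begin
    sumL (λ j′ → ⟦ attPrec (i′ , j′) (i , j) ⟧) (upTo (suc (μ i′))) + excessAt μ (i , j) i′
      ≡⟨ cong₂ _+_ (sumL-upTo-single (suc (μ i′)) (suc j) (λ j′ → attPrec-< i′<i j′ j)) (excessAt-> μ j i′<i) ⟩
    ⟦ j <ᵇ μ i′ ⟧ + ⟦ μ i′ ≡ᵇ j ⟧
      ≡⟨ <ᵇ-suc-split j (μ i′) ⟩
    ⟦ j <ᵇ suc (μ i′) ⟧
      ≡⟨ sumL-upTo-single (suc (μ i′)) j (λ j′ → trans (attPrec-> i′<i j j′) (≡ᵇ-sym j j′)) ⟨
    sumL (λ j′ → ⟦ attPrec (i , j) (i′ , j′) ⟧) (upTo (suc (μ i′)))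
      ∎
    where open ≡-Reasoning
  ... | tri≈ _ i′≡i _ = begin
    sumL (λ j′ → ⟦ attPrec (i′ , j′) (i , j) ⟧) (upTo (suc (μ i′))) + excessAt μ (i , j) i′
      ≡⟨ cong₂ _+_ (sumL-upTo-none (λ j′ → attPrec-≡ i′≡i j′ j)) (excessAt-≡ μ j (sym i′≡i)) ⟩
    0
      ≡⟨ sumL-upTo-none (λ j′ → attPrec-≡ (sym i′≡i) j j′) ⟨
    sumL (λ j′ → ⟦ attPrec (i , j) (i′ , j′) ⟧) (upTo (suc (μ i′)))
      ∎
    where
    open ≡-Reasoning
    sumL-upTo-none : ∀ {f : ℕ → Bool} → (∀ j′ → f j′ ≡ false) → sumL (λ j′ → ⟦ f j′ ⟧) (upTo (suc (μ i′))) ≡ 0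
    sumL-upTo-none f≡ = trans (sumL-cong (upTo (suc (μ i′))) (λ j′ → cong ⟦_⟧ (f≡ j′))) (sumL-zero (upTo (suc (μ i′))))
  attPrec-balance-column μ i zero    basement⇒rightmost i′ | tri> _ _ i<i′ =
    ⊥-elim (<⇒≱ i<i′ (basement⇒rightmost refl i′))
  attPrec-balance-column μ i (suc j) basement⇒rightmost i′ | tri> _ _ i<i′ = begin
    sumL (λ j′ → ⟦ attPrec (i′ , j′) (i , suc j) ⟧) (upTo (suc (μ i′))) + excessAt μ (i , suc j) i′
      ≡⟨ cong₂ _+_ (sumL-upTo-single (suc (μ i′)) (suc j) (λ j′ → attPrec-> i<i′ j′ (suc j))) (excessAt-< μ (suc j) i<i′) ⟩
    ⟦ j <ᵇ μ i′ ⟧ + ⟦ μ i′ ≡ᵇ j ⟧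
      ≡⟨ <ᵇ-suc-split j (μ i′) ⟩
    ⟦ j <ᵇ suc (μ i′) ⟧
      ≡⟨ sumL-upTo-single (suc (μ i′)) j (λ j′ → trans (attPrec-< i<i′ (suc j) j′) (≡ᵇ-sym j j′)) ⟨
    sumL (λ j′ → ⟦ attPrec (i , suc j) (i′ , j′) ⟧) (upTo (suc (μ i′)))
      ∎
    where open ≡-Reasoning

  attPrec-balance : ∀ {n} (μ : Fin n → ℕ) (i : Fin n) j → (j ≡ 0 → ∀ (i′ : Fin n) → toℕ i′ ≤ toℕ i) →
    sumL (λ v → ⟦ attPrec v (i , j) ⟧) (dgHat μ) + excess μ (i , j) ≡ sumL (λ v → ⟦ attPrec (i , j) v ⟧) (dgHat μ)
  attPrec-balance {n} μ i j basement⇒rightmost = begin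
    sumL (λ v → ⟦ attPrec v (i , j) ⟧) (dgHat μ) + excess μ (i , j)
      ≡⟨ cong (_+ excess μ (i , j)) (sumL-dgHat μ _) ⟩
    colSum (suc ∘ μ) (λ i′ j′ → ⟦ attPrec (i′ , j′) (i , j) ⟧) + excess μ (i , j)
      ≡⟨ sumL-distrib-+ _ (excessAt μ (i , j)) (allFin n) ⟨
    sumL (λ i′ → sumL (λ j′ → ⟦ attPrec (i′ , j′) (i , j) ⟧) (upTo (suc (μ i′))) + excessAt μ (i , j) i′) (allFin n)
      ≡⟨ sumL-cong (allFin n) (attPrec-balance-column μ i j basement⇒rightmost) ⟩
    colSum (suc ∘ μ) (λ i′ j′ → ⟦ attPrec (i , j) (i′ , j′) ⟧)
      ≡⟨ sumL-dgHat μ _ ⟨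
    sumL (λ v → ⟦ attPrec (i , j) v ⟧) (dgHat μ)
      ∎
    where open ≡-Reasoning

  -- Inversions

  invAt : ∀ {n} (μ : Fin n → ℕ) → Filling μ → Box n → Box n → ℕ
  invAt μ σ u v = ⟦ attPrec u v ∧ (aug μ σ v <F aug μ σ u) ⟧

  invAt-≡0 : ∀ {n} (μ : Fin n → ℕ) (σ : Filling μ) u v → attPrec u v ≡ false → invAt μ σ u v ≡ 0
  invAt-≡0 μ σ u v ¬uv = cong (λ b → ⟦ b ∧ (aug μ σ v <F aug μ σ u) ⟧) ¬uv

  invCount≡sumL² : ∀ {n} (μ : Fin n → ℕ) (σ : Filling μ) → invCount μ σ ≡ sumL² (invAt μ σ) (dgHat μ)
  invCount≡sumL² μ σ = begin
    invCount μ σ                                            ≡⟨ count≡sumL _ (cartesianProduct (dgHat μ) (dgHat μ)) ⟩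
    sumL _ (cartesianProduct (dgHat μ) (dgHat μ))           ≡⟨ sumL-cartesianProduct _ (dgHat μ) (dgHat μ) ⟩
    sumL² (λ u v → ⟦ attacks u v ∧ precedes u v ∧ (aug μ σ v <F aug μ σ u) ⟧) (dgHat μ)
      ≡⟨ sumL²-cong-∈ (dgHat μ) (λ u v _ _ → cong ⟦_⟧ (sym (∧-assoc (attacks u v) _ _))) ⟩
    sumL² (invAt μ σ) (dgHat μ)                             ∎
    where open ≡-Reasoning

  invAt-πbox-step : ∀ {m} (p : Bool) (a b : Fin (suc m)) → (p ≡ true → a ≢ b) →
    ⟦ p ∧ (πval b <F πval a) ⟧ + ⟦ isLast a ∧ p ⟧ ≡ ⟦ p ∧ (b <F a) ⟧ + ⟦ isLast b ∧ p ⟧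
  invAt-πbox-step false a b _   rewrite ∧-zeroʳ (isLast a) | ∧-zeroʳ (isLast b) = refl
  invAt-πbox-step true  a b a≢b rewrite ∧-identityʳ (isLast a) | ∧-identityʳ (isLast b) = πval-<F-distinct a b (a≢b refl)

  module _ {m} (μ : Fin (suc m) → ℕ) (σ : Filling μ) where

    lastExcess : ℕ
    lastExcess = sumL (λ u → ⟦ isLast (aug μ σ u) ⟧ * excess μ u) (dgHat μ)

    lastFirst lastSecond : Box (suc m) → Box (suc m) → ℕ
    lastFirst  u v = ⟦ isLast (aug μ σ u) ∧ attPrec u v ⟧
    lastSecond u v = ⟦ isLast (aug μ σ v) ∧ attPrec u v ⟧

    invAt-πbox : NonAttacking μ σ → ∀ u v → u ∈ dgHat μ → v ∈ dgHat μ →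
      invAt (πμ μ) (πfill μ σ) (πbox u) (πbox v) + lastFirst u v ≡ invAt μ σ u v + lastSecond u v
    invAt-πbox na u v u∈ v∈ rewrite aug-πfill μ σ u | aug-πfill μ σ v | attPrec-πbox u v =
      invAt-πbox-step (attPrec u v) (aug μ σ u) (aug μ σ v) (na u v u∈ v∈ ∘ ∧-conicalˡ _ _)

    sumL²-invAt-πbox : NonAttacking μ σ →
      sumL² (λ u v → invAt (πμ μ) (πfill μ σ) (πbox u) (πbox v)) (dgHat μ) + sumL² lastFirst (dgHat μ)
      ≡ invCount μ σ + sumL² lastSecond (dgHat μ)
    sumL²-invAt-πbox na = begin
      sumL² (λ u v → invAt (πμ μ) (πfill μ σ) (πbox u) (πbox v)) (dgHat μ) + sumL² lastFirst (dgHat μ)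
        ≡⟨ sumL²-distrib-+ _ lastFirst (dgHat μ) ⟨
      sumL² (λ u v → invAt (πμ μ) (πfill μ σ) (πbox u) (πbox v) + lastFirst u v) (dgHat μ)
        ≡⟨ sumL²-cong-∈ (dgHat μ) (invAt-πbox na) ⟩
      sumL² (λ u v → invAt μ σ u v + lastSecond u v) (dgHat μ)
        ≡⟨ sumL²-distrib-+ (invAt μ σ) lastSecond (dgHat μ) ⟩
      sumL² (invAt μ σ) (dgHat μ) + sumL² lastSecond (dgHat μ)
        ≡⟨ cong (_+ sumL² lastSecond (dgHat μ)) (invCount≡sumL² μ σ) ⟨
      invCount μ σ + sumL² lastSecond (dgHat μ)
        ∎
      where open ≡-Reasoning

    basement-last-rightmost : ∀ i j → isLast (aug μ σ (i , j)) ≡ true →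
      j ≡ 0 → ∀ (i′ : Fin (suc m)) → toℕ i′ ≤ toℕ i
    basement-last-rightmost i .0 last-i refl i′ =
      subst (λ k → toℕ i′ ≤ toℕ k) (sym (isLast⇒≡fromℕ i last-i)) (≤fromℕ i′)

    lastSecond-balance : ∀ w → sumL (λ u → lastSecond u w) (dgHat μ) + ⟦ isLast (aug μ σ w) ⟧ * excess μ w
                               ≡ sumL (lastFirst w) (dgHat μ)
    lastSecond-balance (i , j) with isLast (aug μ σ (i , j)) in last-w
    ... | false = +-identityʳ _
    ... | true  = trans (cong (sumL (λ u → ⟦ attPrec u (i , j) ⟧) (dgHat μ) +_) (+-identityʳ _))
                        (attPrec-balance μ i j (basement-last-rightmost i j last-w))

    sumL²-lastSecond : sumL² lastSecond (dgHat μ) + lastExcess ≡ sumL² lastFirst (dgHat μ)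
    sumL²-lastSecond = begin
      sumL² lastSecond (dgHat μ) + lastExcess
        ≡⟨ cong (_+ lastExcess) (sumL-comm lastSecond (dgHat μ) (dgHat μ)) ⟩
      sumL (λ w → sumL (λ u → lastSecond u w) (dgHat μ)) (dgHat μ) + lastExcess
        ≡⟨ sumL-distrib-+ _ (λ w → ⟦ isLast (aug μ σ w) ⟧ * excess μ w) (dgHat μ) ⟨
      sumL (λ w → sumL (λ u → lastSecond u w) (dgHat μ) + ⟦ isLast (aug μ σ w) ⟧ * excess μ w) (dgHat μ)
        ≡⟨ sumL-cong (dgHat μ) lastSecond-balance ⟩
      sumL² lastFirst (dgHat μ)
        ∎
      where open ≡-Reasoning

    private
      μ′ : Fin (suc m) → ℕ
      μ′ = πμ μ
      invAt′ : Box (suc m) → Box (suc m) → ℕ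
      invAt′ = invAt (πμ μ) (πfill μ σ)

    invAt-into-corner : sumL (λ U → invAt′ U (zero , 0)) (dgHat μ′) ≡ m
    invAt-into-corner = begin
      sumL (λ U → invAt′ U (zero , 0)) (dgHat μ′)
        ≡⟨ sumL-dgHat μ′ _ ⟩
      colSum (suc ∘ μ′) (λ i j → invAt′ (i , j) (zero , 0))
        ≡⟨ sumL-allFin-suc m _ ⟩
      sumL (λ j → invAt′ (zero , j) (zero , 0)) (upTo (suc (μ′ zero)))
        + sumL (λ a → sumL (λ j → invAt′ (suc a , j) (zero , 0)) (upTo (suc (μ (inject₁ a))))) (allFin m)
        ≡⟨ cong₂ _+_ same-column (sumL-cong (allFin m) other-column) ⟩
      sumL (λ _ → 1) (allFin m)
        ≡⟨ sumL-allFin-1 m ⟩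
      m ∎
      where
      open ≡-Reasoning
      same-column : sumL (λ j → invAt′ (zero , j) (zero , 0)) (upTo (suc (μ′ zero))) ≡ 0
      same-column = trans
        (sumL-cong (upTo (suc (μ′ zero))) (λ j → invAt-≡0 μ′ (πfill μ σ) (zero , j) (zero , 0) (attPrec-≡ {suc m} {zero} {zero} refl j 0)))
        (sumL-zero (upTo (suc (μ′ zero))))
      -- in each other column only the basement box attacks and precedes the corner, and its value is larger
      other-column : ∀ a → sumL (λ j → invAt′ (suc a , j) (zero , 0)) (upTo (suc (μ (inject₁ a)))) ≡ 1
      other-column a = trans (sumL-upTo-suc (μ (inject₁ a)) (λ j → invAt′ (suc a , j) (zero , 0)))
                             (cong suc (sumL-zero (upTo (μ (inject₁ a)))))

    invCount-πfill-split :
      invCount μ′ (πfill μ σ) ≡ m + sumL² (λ u v → invAt′ (πbox u) (πbox v)) (dgHat μ)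
    invCount-πfill-split = begin
      invCount μ′ (πfill μ σ)
        ≡⟨ invCount≡sumL² μ′ (πfill μ σ) ⟩
      sumL (λ U → sumL (invAt′ U) (dgHat μ′)) (dgHat μ′)
        ≡⟨ sumL-dgHat-πμ μ (λ U → sumL (invAt′ U) (dgHat μ′)) ⟩
      sumL (invAt′ (zero , 0)) (dgHat μ′) + sumL (λ u → sumL (invAt′ (πbox u)) (dgHat μ′)) (dgHat μ)
        ≡⟨ cong₂ _+_ out-of-corner (sumL-cong (dgHat μ) (λ u → sumL-dgHat-πμ μ (invAt′ (πbox u)))) ⟩
      sumL (λ u → invAt′ (πbox u) (zero , 0) + sumL (λ v → invAt′ (πbox u) (πbox v)) (dgHat μ)) (dgHat μ)
        ≡⟨ sumL-distrib-+ (λ u → invAt′ (πbox u) (zero , 0)) (λ u → sumL (λ v → invAt′ (πbox u) (πbox v)) (dgHat μ)) (dgHat μ) ⟩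
      sumL (λ u → invAt′ (πbox u) (zero , 0)) (dgHat μ) + sumL² (λ u v → invAt′ (πbox u) (πbox v)) (dgHat μ)
        ≡⟨ cong (_+ sumL² (λ u v → invAt′ (πbox u) (πbox v)) (dgHat μ)) (trans (sym (sumL-dgHat-πμ μ (λ U → invAt′ U (zero , 0)))) invAt-into-corner) ⟩
      m + sumL² (λ u v → invAt′ (πbox u) (πbox v)) (dgHat μ)
        ∎
      where
      open ≡-Reasoning
      out-of-corner : sumL (invAt′ (zero , 0)) (dgHat μ′) ≡ 0
      out-of-corner = trans (sumL-cong (dgHat μ′) (λ V → invAt-≡0 μ′ (πfill μ σ) (zero , 0) V (attPrec-corner V))) (sumL-zero (dgHat μ′))

    invCount-πfill : NonAttacking μ σ → invCount μ′ (πfill μ σ) + lastExcess ≡ invCount μ σ + m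
    invCount-πfill na = begin
      invCount μ′ (πfill μ σ) + lastExcess    ≡⟨ cong (_+ lastExcess) invCount-πfill-split ⟩
      m + S′ + lastExcess                      ≡⟨ +-assoc m S′ lastExcess ⟩
      m + (S′ + lastExcess)                    ≡⟨ cong (m +_) images ⟩
      m + invCount μ σ                         ≡⟨ +-comm m _ ⟩
      invCount μ σ + m                         ∎
      where
      open ≡-Reasoning
      S′ NF NS : ℕ
      S′ = sumL² (λ u v → invAt′ (πbox u) (πbox v)) (dgHat μ)
      NF = sumL² lastFirst (dgHat μ)
      NS = sumL² lastSecond (dgHat μ)
      images : S′ + lastExcess ≡ invCount μ σ
      images = +-cancelʳ-≡ NS _ _ (begin
        S′ + lastExcess + NS     ≡⟨ +-assoc S′ lastExcess NS ⟩
        S′ + (lastExcess + NS)   ≡⟨ cong (S′ +_) (trans (+-comm lastExcess NS) sumL²-lastSecond) ⟩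
        S′ + NF                  ≡⟨ sumL²-invAt-πbox na ⟩
        invCount μ σ + NS        ∎)

  -- Arms and coTriv

  armAt : ∀ {n} → (Fin n → ℕ) → Box n → Fin n → ℕ
  armAt μ (i , j) i′ = ⟦ (i′ <F i) ∧ (μ i′ ≤ᵇ μ i) ∧ (1 ≤ᵇ j) ∧ (j ≤ᵇ μ i′) ⟧
                     + ⟦ (i <F i′) ∧ (μ i′ <ᵇ μ i) ∧ (j ∸ 1 ≤ᵇ μ i′) ⟧

  arm≡sumL-armAt : ∀ {n} (μ : Fin n → ℕ) u → arm μ u ≡ sumL (armAt μ u) (allFin n)
  arm≡sumL-armAt {n} μ (i , j) =
    trans (cong₂ _+_ (count≡sumL _ (allFin n)) (count≡sumL _ (allFin n))) (sym (sumL-distrib-+ _ _ (allFin n)))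

  module _ {n} (μ : Fin n → ℕ) (i : Fin n) where

    armAt-step : ∀ j → j < μ i → ∀ i′ →
      armAt μ (i , suc j) i′ ≡ excessAt μ (i , suc j) i′ + armAt μ (i , suc (suc j)) i′
    armAt-step j j<μi i′ = trans
      (cong₂ _+_ (⟦∧⟧-peel (i′ <F i) (μ i′ ≤ᵇ μ i) (suc j) (μ i′) (λ at-j → subst (λ x → (x ≤ᵇ μ i) ≡ true) (sym at-j) (≤ᵇ-true j<μi)))
                 (⟦∧⟧-peel (i <F i′) (μ i′ <ᵇ μ i) j (μ i′) (λ at-j → subst (λ x → (x <ᵇ μ i) ≡ true) (sym at-j) (<ᵇ-true j<μi))))
      (interchange ⟦ (i′ <F i) ∧ (μ i′ ≡ᵇ suc j) ⟧ ⟦ (i′ <F i) ∧ (μ i′ ≤ᵇ μ i) ∧ (suc (suc j) ≤ᵇ μ i′) ⟧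
                   ⟦ (i <F i′) ∧ (μ i′ ≡ᵇ j) ⟧ ⟦ (i <F i′) ∧ (μ i′ <ᵇ μ i) ∧ (suc j ≤ᵇ μ i′) ⟧)
      where
      interchange : ∀ a b c d → a + b + (c + d) ≡ a + c + (b + d)
      interchange = solve-∀

    arm-step : ∀ j → j < μ i → arm μ (i , suc j) ≡ excess μ (i , suc j) + arm μ (i , suc (suc j))
    arm-step j j<μi = begin
      arm μ (i , suc j)                                                          ≡⟨ arm≡sumL-armAt μ (i , suc j) ⟩
      sumL (armAt μ (i , suc j)) (allFin n)                                      ≡⟨ sumL-cong (allFin n) (armAt-step j j<μi) ⟩
      sumL (λ i′ → excessAt μ (i , suc j) i′ + armAt μ (i , suc (suc j)) i′) (allFin n)
                                                                                 ≡⟨ sumL-distrib-+ _ _ (allFin n) ⟩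
      excess μ (i , suc j) + sumL (armAt μ (i , suc (suc j))) (allFin n)         ≡⟨ cong (excess μ (i , suc j) +_) (arm≡sumL-armAt μ (i , suc (suc j))) ⟨
      excess μ (i , suc j) + arm μ (i , suc (suc j))                             ∎
      where open ≡-Reasoning

    arm-above-top : arm μ (i , suc (μ i)) ≡ 0
    arm-above-top = trans (arm≡sumL-armAt μ (i , suc (μ i)))
      (trans (sumL-cong (allFin n) no-column) (sumL-zero (allFin n)))
      where
      no-column : ∀ i′ → armAt μ (i , suc (μ i)) i′ ≡ 0
      no-column i′ = cong₂ _+_
        (trans (cong (λ b → ⟦ (i′ <F i) ∧ b ⟧) (≤ᵇ∧>ᵇ (μ i′) (μ i))) (cong ⟦_⟧ (∧-zeroʳ _)))
        (trans (cong (λ b → ⟦ (i <F i′) ∧ b ⟧) (<ᵇ∧≥ᵇ (μ i′) (μ i))) (cong ⟦_⟧ (∧-zeroʳ _)))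

    arm-top : ∀ j → suc j ≡ μ i → arm μ (i , suc j) ≡ excess μ (i , suc j)
    arm-top j sj≡μi = begin
      arm μ (i , suc j)                                ≡⟨ arm-step j (subst (j <_) sj≡μi (n<1+n j)) ⟩
      excess μ (i , suc j) + arm μ (i , suc (suc j))   ≡⟨ cong (λ k → excess μ (i , suc j) + arm μ (i , suc k)) sj≡μi ⟩
      excess μ (i , suc j) + arm μ (i , suc (μ i))     ≡⟨ cong (excess μ (i , suc j) +_) arm-above-top ⟩
      excess μ (i , suc j) + 0                         ≡⟨ +-identityʳ _ ⟩
      excess μ (i , suc j)                             ∎
      where open ≡-Reasoning

  bottomWeight : ℕ → (ℕ → ℕ) → ℕ
  bottomWeight zero    w = 0
  bottomWeight (suc _) w = w 1

  coTrivAt : ∀ {n} → (Fin n → ℕ) → Fin n → Fin n → ℕ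
  coTrivAt μ i i′ = ⟦ (i <F i′) ∧ (μ i ≤ᵇ μ i′) ⟧

  coTriv≡sumL² : ∀ {n} (μ : Fin n → ℕ) → coTriv μ ≡ sumL² (coTrivAt μ) (allFin n)
  coTriv≡sumL² {n} μ =
    trans (count≡sumL _ (cartesianProduct (allFin n) (allFin n))) (sumL-cartesianProduct _ (allFin n) (allFin n))

  module _ {m} (μ : Fin (suc m) → ℕ) where

    private
      μ′ : Fin (suc m) → ℕ
      μ′ = πμ μ
      μℓ : ℕ
      μℓ = μ (fromℕ m)
      ℓ : Fin (suc m)
      ℓ = fromℕ m

    notTaller taller : ℕ
    notTaller = sumL (λ a → ⟦ μ (inject₁ a) ≤ᵇ μℓ ⟧) (allFin m)
    taller    = sumL (λ a → ⟦ suc μℓ ≤ᵇ μ (inject₁ a) ⟧) (allFin m)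

    notTaller+taller : notTaller + taller ≡ m
    notTaller+taller = begin
      notTaller + taller                      ≡⟨ sumL-distrib-+ _ _ (allFin m) ⟨
      sumL (λ a → ⟦ μ (inject₁ a) ≤ᵇ μℓ ⟧ + ⟦ suc μℓ ≤ᵇ μ (inject₁ a) ⟧) (allFin m)
                                              ≡⟨ sumL-cong (allFin m) (λ a → ≤ᵇ-dichotomy (μ (inject₁ a)) μℓ) ⟩
      sumL (λ _ → 1) (allFin m)               ≡⟨ sumL-allFin-1 m ⟩
      m                                       ∎
      where
      open ≡-Reasoning
      ≤ᵇ-dichotomy : ∀ x y → ⟦ x ≤ᵇ y ⟧ + ⟦ suc y ≤ᵇ x ⟧ ≡ 1
      ≤ᵇ-dichotomy zero    y       = refl
      ≤ᵇ-dichotomy (suc x) zero    = refl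
      ≤ᵇ-dichotomy (suc x) (suc y) = trans (cong (λ b → ⟦ b ⟧ + ⟦ suc y ≤ᵇ x ⟧) (sym (≤ᵇ≡<ᵇ-suc x y))) (≤ᵇ-dichotomy x y)

    armAt-πbox-corner : ∀ i j → armAt μ′ (πbox (i , suc j)) zero ≡ armAt μ (i , suc j) (fromℕ m)
    armAt-πbox-corner i j with lastView i
    ... | inj a rewrite toℕ-inject₁ a | toℕ-fromℕ m | inject₁<ᵇfromℕ a | fromℕ<ᵇinject₁ a | ≤ᵇ≡<ᵇ-suc j μℓ = +-identityʳ _
    ... | last  rewrite toℕ-fromℕ m | <ᵇ-false (≤-refl {m}) = refl

    armAt-πbox-suc : ∀ i j b → armAt μ′ (πbox (i , suc j)) (suc b) ≡ armAt μ (i , suc j) (inject₁ b)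
    armAt-πbox-suc i j b with lastView i
    ... | inj a rewrite toℕ-inject₁ a | toℕ-inject₁ b = refl
    ... | last  rewrite toℕ-inject₁ b | toℕ-fromℕ m | inject₁<ᵇfromℕ b | fromℕ<ᵇinject₁ b | ≤ᵇ≡<ᵇ-suc (μ (inject₁ b)) μℓ = sym (+-identityʳ _)

    arm-πbox : ∀ i j → arm μ′ (πbox (i , suc j)) ≡ arm μ (i , suc j)
    arm-πbox i j = begin
      arm μ′ (πbox (i , suc j))                         ≡⟨ arm≡sumL-armAt μ′ (πbox (i , suc j)) ⟩
      sumL (armAt μ′ (πbox (i , suc j))) (allFin (suc m)) ≡⟨ sumL-allFin-rotate m (armAt-πbox-corner i j) (armAt-πbox-suc i j) ⟩
      sumL (armAt μ (i , suc j)) (allFin (suc m))       ≡⟨ arm≡sumL-armAt μ (i , suc j) ⟨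
      arm μ (i , suc j)                                 ∎
      where open ≡-Reasoning

    arm-corner : arm μ′ (zero , 1) ≡ notTaller
    arm-corner = trans (arm≡sumL-armAt μ′ (zero , 1)) (trans (sumL-allFin-suc m (armAt μ′ (zero , 1)))
      (sumL-cong (allFin m) (λ b → cong ⟦_⟧ (trans (∧-identityʳ _) (sym (≤ᵇ≡<ᵇ-suc (μ (inject₁ b)) μℓ))))))

    sumL-arm-πμ : sumL (arm μ′) (dg′ μ′) ≡ notTaller + sumL (arm μ) (dg′ μ)
    sumL-arm-πμ = begin
      sumL (arm μ′) (dg′ μ′)                           ≡⟨ sumL-dg′-πμ μ (arm μ′) ⟩
      arm μ′ (zero , 1) + sumL (arm μ′ ∘ πbox) (dg′ μ)  ≡⟨ cong₂ _+_ arm-corner (sumL-dg′ μ (arm μ′ ∘ πbox)) ⟩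
      notTaller + colSum μ (λ i j → arm μ′ (πbox (i , suc j)))
                                                       ≡⟨ cong (notTaller +_) (colSum-cong μ arm-πbox) ⟩
      notTaller + colSum μ (λ i j → arm μ (i , suc j)) ≡⟨ cong (notTaller +_) (sumL-dg′ μ (arm μ)) ⟨
      notTaller + sumL (arm μ) (dg′ μ)                 ∎
      where open ≡-Reasoning

    private
      innerPairs : ℕ
      innerPairs = sumL² (λ a b → coTrivAt μ (inject₁ a) (inject₁ b)) (allFin m)

    coTriv-πμ-rows : coTriv μ′ ≡ taller + innerPairs
    coTriv-πμ-rows = begin
      coTriv μ′                                                      ≡⟨ coTriv≡sumL² μ′ ⟩
      sumL² (coTrivAt μ′) (allFin (suc m))                           ≡⟨ sumL-allFin-suc m _ ⟩
      sumL (coTrivAt μ′ zero) (allFin (suc m))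
        + sumL (λ a → sumL (coTrivAt μ′ (suc a)) (allFin (suc m))) (allFin m)
                                                                     ≡⟨ cong₂ _+_ (sumL-allFin-suc m (coTrivAt μ′ zero)) (sumL-cong (allFin m) row-suc) ⟩
      taller + innerPairs                                            ∎
      where
      open ≡-Reasoning
      row-suc : ∀ a → sumL (coTrivAt μ′ (suc a)) (allFin (suc m)) ≡ sumL (λ b → coTrivAt μ (inject₁ a) (inject₁ b)) (allFin m)
      row-suc a = trans (sumL-allFin-suc m (coTrivAt μ′ (suc a))) (sumL-cong (allFin m) (λ b → coTrivAt-πμ b))
        where
        coTrivAt-πμ : ∀ b → coTrivAt μ′ (suc a) (suc b) ≡ coTrivAt μ (inject₁ a) (inject₁ b)
        coTrivAt-πμ b rewrite toℕ-inject₁ a | toℕ-inject₁ b = refl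

    coTriv-rows : coTriv μ ≡ innerPairs + notTaller
    coTriv-rows = begin
      coTriv μ                                                       ≡⟨ coTriv≡sumL² μ ⟩
      sumL² (coTrivAt μ) (allFin (suc m))                            ≡⟨ sumL-allFin-last m _ ⟩
      sumL (λ a → sumL (coTrivAt μ (inject₁ a)) (allFin (suc m))) (allFin m)
        + sumL (coTrivAt μ (fromℕ m)) (allFin (suc m))               ≡⟨ cong₂ _+_ (sumL-cong (allFin m) row-inject₁) row-last ⟩
      sumL (λ a → sumL (λ b → coTrivAt μ (inject₁ a) (inject₁ b)) (allFin m) + ⟦ μ (inject₁ a) ≤ᵇ μℓ ⟧) (allFin m) + 0
                                                                     ≡⟨ +-identityʳ _ ⟩
      sumL (λ a → sumL (λ b → coTrivAt μ (inject₁ a) (inject₁ b)) (allFin m) + ⟦ μ (inject₁ a) ≤ᵇ μℓ ⟧) (allFin m)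
                                                                     ≡⟨ sumL-distrib-+ _ _ (allFin m) ⟩
      innerPairs + notTaller                                         ∎
      where
      open ≡-Reasoning
      row-inject₁ : ∀ a → sumL (coTrivAt μ (inject₁ a)) (allFin (suc m))
                          ≡ sumL (λ b → coTrivAt μ (inject₁ a) (inject₁ b)) (allFin m) + ⟦ μ (inject₁ a) ≤ᵇ μℓ ⟧
      row-inject₁ a = trans (sumL-allFin-last m (coTrivAt μ (inject₁ a)))
                            (cong (sumL (λ b → coTrivAt μ (inject₁ a) (inject₁ b)) (allFin m) +_) last-column)
        where
        last-column : coTrivAt μ (inject₁ a) (fromℕ m) ≡ ⟦ μ (inject₁ a) ≤ᵇ μℓ ⟧
        last-column rewrite toℕ-inject₁ a | toℕ-fromℕ m | inject₁<ᵇfromℕ a = refl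
      row-last : sumL (coTrivAt μ (fromℕ m)) (allFin (suc m)) ≡ 0
      row-last = trans (sumL-cong (allFin (suc m)) nothing-right-of-last) (sumL-zero (allFin (suc m)))
        where
        nothing-right-of-last : ∀ b → coTrivAt μ (fromℕ m) b ≡ 0
        nothing-right-of-last b = cong (λ x → ⟦ x ∧ (μℓ ≤ᵇ μ b) ⟧) (<ᵇ-false (≤fromℕ b))

    coTriv-πμ : coTriv μ′ + notTaller ≡ coTriv μ + taller
    coTriv-πμ = begin
      coTriv μ′ + notTaller                ≡⟨ cong (_+ notTaller) coTriv-πμ-rows ⟩
      taller + innerPairs + notTaller      ≡⟨ rotate taller innerPairs notTaller ⟩
      innerPairs + notTaller + taller      ≡⟨ cong (_+ taller) coTriv-rows ⟨
      coTriv μ + taller                    ∎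
      where
      open ≡-Reasoning
      rotate : ∀ a b c → a + b + c ≡ b + c + a
      rotate = solve-∀

    bottomWeight-arm : bottomWeight μℓ (λ j → arm μ (ℓ , j)) ≡ arm μ (ℓ , 1)
    bottomWeight-arm = bottom μℓ refl
      where
      bottom : ∀ k → k ≡ μℓ → bottomWeight k (λ j → arm μ (ℓ , j)) ≡ arm μ (ℓ , 1)
      bottom zero    0≡μℓ = sym (subst (λ k → arm μ (ℓ , suc k) ≡ 0) (sym 0≡μℓ) (arm-above-top μ ℓ))
      bottom (suc _) _    = refl

    notTaller-split : notTaller ≡ excess μ (ℓ , 0) + arm μ (ℓ , 1)
    notTaller-split = begin
      notTaller                                                   ≡⟨ sumL-cong (allFin m) column ⟩
      sumL (λ a → both (inject₁ a)) (allFin m)                    ≡⟨ +-identityʳ _ ⟨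
      sumL (λ a → both (inject₁ a)) (allFin m) + 0                ≡⟨ cong (sumL (λ a → both (inject₁ a)) (allFin m) +_) last-column ⟨
      sumL (λ a → both (inject₁ a)) (allFin m) + both ℓ           ≡⟨ sumL-allFin-last m both ⟨
      sumL both (allFin (suc m))                                  ≡⟨ sumL-distrib-+ (excessAt μ (ℓ , 0)) (armAt μ (ℓ , 1)) (allFin (suc m)) ⟩
      excess μ (ℓ , 0) + sumL (armAt μ (ℓ , 1)) (allFin (suc m))  ≡⟨ cong (excess μ (ℓ , 0) +_) (arm≡sumL-armAt μ (ℓ , 1)) ⟨
      excess μ (ℓ , 0) + arm μ (ℓ , 1)                            ∎
      where
      open ≡-Reasoning
      both : Fin (suc m) → ℕ
      both i′ = excessAt μ (ℓ , 0) i′ + armAt μ (ℓ , 1) i′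
      column : ∀ a → ⟦ μ (inject₁ a) ≤ᵇ μℓ ⟧ ≡ both (inject₁ a)
      column a rewrite toℕ-inject₁ a | toℕ-fromℕ m | inject₁<ᵇfromℕ a | fromℕ<ᵇinject₁ a
                     | +-identityʳ ⟦ μ (inject₁ a) ≡ᵇ 0 ⟧ | +-identityʳ ⟦ (μ (inject₁ a) ≤ᵇ μℓ) ∧ (1 ≤ᵇ μ (inject₁ a)) ⟧ =
        ≤ᵇ-split-zero (μ (inject₁ a)) μℓ
      last-column : both ℓ ≡ 0
      last-column rewrite <ᵇ-false (≤-refl {toℕ ℓ}) = refl

  -- Descents

  weightedDes : ∀ {n} (μ : Fin n → ℕ) → Filling μ → (Box n → ℕ) → ℕ
  weightedDes μ σ W = sumL (λ u → if isDes μ σ u then W u else 0) (dg′ μ)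

  weightedDes≡colSum : ∀ {n} (μ : Fin n → ℕ) (σ : Filling μ) (W : Box n → ℕ) →
    weightedDes μ σ W ≡ colSum μ (λ i j → ⟦ isDes μ σ (i , suc j) ⟧ * W (i , suc j))
  weightedDes≡colSum μ σ W = trans (sumL-dg′ μ _) (colSum-cong μ (λ i j → if-else-0 (isDes μ σ (i , suc j)) _))

  -- Along a column, f marks the rows holding n; if w is the tail sum of δ over rows 1 … k, every maximal
  -- run of marked rows contributes the same on both sides.
  telescope : ∀ k (f : ℕ → Bool) (w δ : ℕ → ℕ) →
    (∀ j → suc j < k → w (suc j) ≡ δ (suc j) + w (suc (suc j))) →
    (∀ j → suc j ≡ k → w (suc j) ≡ δ (suc j)) →
    sumL (λ j → ⟦ f j ∧ not (f (suc j)) ⟧ * w (suc j)) (upTo k) + sumL (λ j → ⟦ f (suc j) ⟧ * δ (suc j)) (upTo k)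
    ≡ sumL (λ j → ⟦ f (suc j) ∧ not (f j) ⟧ * w (suc j)) (upTo k) + ⟦ f 0 ⟧ * bottomWeight k w
  telescope zero    f w δ _    _   = sym (*-zeroʳ ⟦ f 0 ⟧)
  telescope (suc k) f w δ step top = begin
    sumL (λ j → g j * w (suc j)) (upTo (suc k)) + sumL (λ j → ⟦ f (suc j) ⟧ * δ (suc j)) (upTo (suc k))
      ≡⟨ cong₂ _+_ (sumL-upTo-suc k (λ j → g j * w (suc j))) (sumL-upTo-suc k (λ j → ⟦ f (suc j) ⟧ * δ (suc j))) ⟩
    (g 0 * w 1 + G) + (f1 * δ 1 + D)
      ≡⟨ regroup₁ (g 0 * w 1) G (f1 * δ 1) D ⟩
    g 0 * w 1 + f1 * δ 1 + (G + D)
      ≡⟨ cong (g 0 * w 1 + f1 * δ 1 +_) (telescope k (f ∘ suc) (w ∘ suc) (δ ∘ suc) (λ j → step (suc j) ∘ s<s) (λ j → top (suc j) ∘ cong suc)) ⟩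
    g 0 * w 1 + f1 * δ 1 + (L + f1 * h)
      ≡⟨ regroup₂ (g 0) (w 1) f1 (δ 1) L h ⟩
    g 0 * w 1 + f1 * (δ 1 + h) + L
      ≡⟨ cong (λ x → g 0 * w 1 + f1 * x + L) (sym w1≡δ1+h) ⟩
    g 0 * w 1 + f1 * w 1 + L
      ≡⟨ cong (_+ L) (*-distribʳ-+ (w 1) (g 0) f1) ⟨
    (g 0 + f1) * w 1 + L
      ≡⟨ cong (λ x → x * w 1 + L) (⟦∧not⟧-swap (f 0) (f 1)) ⟩
    (l 0 + ⟦ f 0 ⟧) * w 1 + L
      ≡⟨ regroup₃ (l 0) ⟦ f 0 ⟧ (w 1) L ⟩
    (l 0 * w 1 + L) + ⟦ f 0 ⟧ * w 1
      ≡⟨ cong (_+ ⟦ f 0 ⟧ * w 1) (sumL-upTo-suc k (λ j → l j * w (suc j))) ⟨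
    sumL (λ j → l j * w (suc j)) (upTo (suc k)) + ⟦ f 0 ⟧ * w 1
      ∎
    where
    open ≡-Reasoning
    g l : ℕ → ℕ
    g j = ⟦ f j ∧ not (f (suc j)) ⟧
    l j = ⟦ f (suc j) ∧ not (f j) ⟧
    f1 h G D L : ℕ
    f1 = ⟦ f 1 ⟧
    h  = bottomWeight k (w ∘ suc)
    G  = sumL (λ j → g (suc j) * w (suc (suc j))) (upTo k)
    D  = sumL (λ j → ⟦ f (suc (suc j)) ⟧ * δ (suc (suc j))) (upTo k)
    L  = sumL (λ j → l (suc j) * w (suc (suc j))) (upTo k)
    w1≡δ1+h : w 1 ≡ δ 1 + h
    w1≡δ1+h = first-row k refl
      where
      first-row : ∀ k′ → k′ ≡ k → w 1 ≡ δ 1 + bottomWeight k′ (w ∘ suc)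
      first-row zero    k′≡k = trans (top 0 (cong suc k′≡k)) (sym (+-identityʳ (δ 1)))
      first-row (suc _) k′≡k = step 0 (subst (1 <_) (cong suc k′≡k) (s<s z<s))
    regroup₁ : ∀ a b c d → a + b + (c + d) ≡ a + c + (b + d)
    regroup₁ = solve-∀
    regroup₂ : ∀ a b c d e x → a * b + c * d + (e + c * x) ≡ a * b + c * (d + x) + e
    regroup₂ = solve-∀
    regroup₃ : ∀ a b c d → (a + b) * c + d ≡ (a * c + d) + b * c
    regroup₃ = solve-∀

  module _ {m} (μ : Fin (suc m) → ℕ) (σ : Filling μ) where

    private
      μ′ : Fin (suc m) → ℕ
      μ′ = πμ μ
      σ′ : Filling μ′
      σ′ = πfill μ σ

    holdsLast : Fin (suc m) → ℕ → Bool
    holdsLast i j = isLast (aug μ σ (i , j))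

    desLost desGained : Fin (suc m) → ℕ → Bool
    desLost   i j = holdsLast i (suc j) ∧ not (holdsLast i j)
    desGained i j = holdsLast i j ∧ not (holdsLast i (suc j))

    isDes-πbox-step : ∀ i j →
      ⟦ isDes μ′ σ′ (πbox (i , suc j)) ⟧ + ⟦ desLost i j ⟧ ≡ ⟦ isDes μ σ (i , suc j) ⟧ + ⟦ desGained i j ⟧
    isDes-πbox-step i j rewrite down-πbox-up i j | aug-πfill μ σ (i , j) | aug-πfill μ σ (i , suc j) =
      πval-<F (aug μ σ (i , suc j)) (aug μ σ (i , j))

    sumOnLast : (Box (suc m) → ℕ) → ℕ
    sumOnLast δ = colSum μ (λ i j → ⟦ holdsLast i (suc j) ⟧ * δ (i , suc j))

    isDes-corner : isDes μ′ σ′ (zero , 1) ≡ false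
    isDes-corner = cong (λ x → 0 <ᵇ toℕ x) (πval-fromℕ m)

    module _ (W′ W : Box (suc m) → ℕ) (W′∘πbox : ∀ i j → W′ (πbox (i , suc j)) ≡ W (i , suc j)) where

      desImage lost des gained : Fin (suc m) → ℕ → ℕ
      desImage i j = ⟦ isDes μ′ σ′ (πbox (i , suc j)) ⟧ * W (i , suc j)
      lost     i j = ⟦ desLost i j ⟧ * W (i , suc j)
      des      i j = ⟦ isDes μ σ (i , suc j) ⟧ * W (i , suc j)
      gained   i j = ⟦ desGained i j ⟧ * W (i , suc j)

      weightedDes-πfill-images : weightedDes μ′ σ′ W′ ≡ colSum μ desImage
      weightedDes-πfill-images = begin
        weightedDes μ′ σ′ W′
          ≡⟨ sumL-dg′-πμ μ F′ ⟩
        F′ (zero , 1) + sumL (F′ ∘ πbox) (dg′ μ)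
          ≡⟨ cong (λ b → (if b then W′ (zero , 1) else 0) + sumL (F′ ∘ πbox) (dg′ μ)) isDes-corner ⟩
        sumL (F′ ∘ πbox) (dg′ μ)
          ≡⟨ sumL-dg′ μ (F′ ∘ πbox) ⟩
        colSum μ (λ i j → F′ (πbox (i , suc j)))
          ≡⟨ colSum-cong μ (λ i j → trans (if-else-0 (isDes μ′ σ′ (πbox (i , suc j))) _)
                                          (cong (⟦ isDes μ′ σ′ (πbox (i , suc j)) ⟧ *_) (W′∘πbox i j))) ⟩
        colSum μ desImage
          ∎
        where
        open ≡-Reasoning
        F′ : Box (suc m) → ℕ
        F′ U = if isDes μ′ σ′ U then W′ U else 0

      weightedDes-πfill-exchange : weightedDes μ′ σ′ W′ + colSum μ lost ≡ weightedDes μ σ W + colSum μ gained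
      weightedDes-πfill-exchange = begin
        weightedDes μ′ σ′ W′ + colSum μ lost                   ≡⟨ cong (_+ colSum μ lost) weightedDes-πfill-images ⟩
        colSum μ desImage + colSum μ lost                      ≡⟨ colSum-distrib-+ μ desImage lost ⟨
        colSum μ (λ i j → desImage i j + lost i j)             ≡⟨ colSum-cong μ step ⟩
        colSum μ (λ i j → des i j + gained i j)                ≡⟨ colSum-distrib-+ μ des gained ⟩
        colSum μ des + colSum μ gained                         ≡⟨ cong (_+ colSum μ gained) (weightedDes≡colSum μ σ W) ⟨
        weightedDes μ σ W + colSum μ gained                    ∎
        where
        open ≡-Reasoning
        step : ∀ i j → desImage i j + lost i j ≡ des i j + gained i j
        step i j = begin
          desImage i j + lost i j                                           ≡⟨ *-distribʳ-+ w ⟦ isDes μ′ σ′ (πbox (i , suc j)) ⟧ ⟦ desLost i j ⟧ ⟨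
          (⟦ isDes μ′ σ′ (πbox (i , suc j)) ⟧ + ⟦ desLost i j ⟧) * w         ≡⟨ cong (_* w) (isDes-πbox-step i j) ⟩
          (⟦ isDes μ σ (i , suc j) ⟧ + ⟦ desGained i j ⟧) * w                ≡⟨ *-distribʳ-+ w ⟦ isDes μ σ (i , suc j) ⟧ ⟦ desGained i j ⟧ ⟩
          des i j + gained i j                                              ∎
          where w = W (i , suc j)

      module _ (δ : Box (suc m) → ℕ)
               (W-step : ∀ i j → suc j < μ i → W (i , suc j) ≡ δ (i , suc j) + W (i , suc (suc j)))
               (W-top  : ∀ i j → suc j ≡ μ i → W (i , suc j) ≡ δ (i , suc j)) where

        telescope-columns :
          colSum μ gained + sumOnLast δ ≡ colSum μ lost + bottomWeight (μ (fromℕ m)) (λ j → W (fromℕ m , j))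
        telescope-columns = begin
          colSum μ gained + sumOnLast δ
            ≡⟨ sumL-distrib-+ (λ i → sumL (gained i) (upTo (μ i))) (λ i → sumL (δ′ i) (upTo (μ i))) (allFin (suc m)) ⟨
          sumL (λ i → sumL (gained i) (upTo (μ i)) + sumL (δ′ i) (upTo (μ i))) (allFin (suc m))
            ≡⟨ sumL-cong (allFin (suc m)) (λ i → telescope (μ i) (holdsLast i) (λ j → W (i , j)) (λ j → δ (i , j)) (W-step i) (W-top i)) ⟩
          sumL (λ i → sumL (lost i) (upTo (μ i)) + ⟦ isLast i ⟧ * bottom i) (allFin (suc m))
            ≡⟨ sumL-distrib-+ (λ i → sumL (lost i) (upTo (μ i))) (λ i → ⟦ isLast i ⟧ * bottom i) (allFin (suc m)) ⟩
          colSum μ lost + sumL (λ i → ⟦ isLast i ⟧ * bottom i) (allFin (suc m))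
            ≡⟨ cong (colSum μ lost +_) (sumL-allFin-isLast bottom) ⟩
          colSum μ lost + bottom (fromℕ m)
            ∎
          where
          open ≡-Reasoning
          δ′ : Fin (suc m) → ℕ → ℕ
          δ′ i j = ⟦ holdsLast i (suc j) ⟧ * δ (i , suc j)
          bottom : Fin (suc m) → ℕ
          bottom i = bottomWeight (μ i) (λ j → W (i , j))

        weightedDes-πfill :
          weightedDes μ′ σ′ W′ + sumOnLast δ ≡ weightedDes μ σ W + bottomWeight (μ (fromℕ m)) (λ j → W (fromℕ m , j))
        weightedDes-πfill =
          +-exchange-cancel {weightedDes μ′ σ′ W′} {sumOnLast δ} {weightedDes μ σ W} {B} {colSum μ lost} {colSum μ gained}
            weightedDes-πfill-exchange telescope-columns
          where
          B : ℕ
          B = bottomWeight (μ (fromℕ m)) (λ j → W (fromℕ m , j))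

  maj-πfill : ∀ {m} (μ : Fin (suc m) → ℕ) (σ : Filling μ) →
    maj (πμ μ) (πfill μ σ) + rCount μ σ ≡ maj μ σ + μ (fromℕ m)
  maj-πfill {m} μ σ = begin
    maj (πμ μ) (πfill μ σ) + rCount μ σ
      ≡⟨ cong (maj (πμ μ) (πfill μ σ) +_) rCount≡sumOnLast ⟩
    maj (πμ μ) (πfill μ σ) + sumOnLast μ σ (λ _ → 1)
      ≡⟨ weightedDes-πfill μ σ (λ U → leg (πμ μ) U + 1) (λ u → leg μ u + 1) leg-πbox (λ _ → 1) leg-step leg-top ⟩
    maj μ σ + bottomWeight (μ (fromℕ m)) (λ j → μ (fromℕ m) ∸ j + 1)
      ≡⟨ cong (maj μ σ +_) (bottom-leg (μ (fromℕ m))) ⟩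
    maj μ σ + μ (fromℕ m)
      ∎
    where
    open ≡-Reasoning
    rCount≡sumOnLast : rCount μ σ ≡ sumOnLast μ σ (λ _ → 1)
    rCount≡sumOnLast = trans (count≡sumL _ (dg′ μ)) (trans (sumL-dg′ μ _) (colSum-cong μ (λ i j → sym (*-identityʳ _))))
    leg-πbox : ∀ i j → leg (πμ μ) (πbox (i , suc j)) + 1 ≡ leg μ (i , suc j) + 1
    leg-πbox i j with lastView i
    ... | inj a = refl
    ... | last  = refl
    leg-step : ∀ i j → suc j < μ i → μ i ∸ suc j + 1 ≡ 1 + (μ i ∸ suc (suc j) + 1)
    leg-step i j sj<μi = cong (_+ 1) (∸-suc-step (μ i) (suc j) sj<μi)
    leg-top : ∀ i j → suc j ≡ μ i → μ i ∸ suc j + 1 ≡ 1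
    leg-top i j sj≡μi = cong (_+ 1) (trans (cong (μ i ∸_) sj≡μi) (n∸n≡0 (μ i)))
    bottom-leg : ∀ k → bottomWeight k (λ j → k ∸ j + 1) ≡ k
    bottom-leg zero    = refl
    bottom-leg (suc k) = +-comm k 1

  module _ {m} (μ : Fin (suc m) → ℕ) (σ : Filling μ) where

    private
      ℓ : Fin (suc m)
      ℓ = fromℕ m

    lastExcess-split : lastExcess μ σ ≡ excess μ (ℓ , 0) + sumOnLast μ σ (excess μ)
    lastExcess-split = begin
      lastExcess μ σ
        ≡⟨ sumL-dgHat μ _ ⟩
      colSum (suc ∘ μ) (λ i j → ⟦ holdsLast μ σ i j ⟧ * excess μ (i , j))
        ≡⟨ sumL-cong (allFin (suc m)) (λ i → sumL-upTo-suc (μ i) (λ j → ⟦ holdsLast μ σ i j ⟧ * excess μ (i , j))) ⟩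
      sumL (λ i → ⟦ isLast i ⟧ * excess μ (i , 0) + sumL (λ j → ⟦ holdsLast μ σ i (suc j) ⟧ * excess μ (i , suc j)) (upTo (μ i))) (allFin (suc m))
        ≡⟨ sumL-distrib-+ (λ i → ⟦ isLast i ⟧ * excess μ (i , 0))
                          (λ i → sumL (λ j → ⟦ holdsLast μ σ i (suc j) ⟧ * excess μ (i , suc j)) (upTo (μ i))) (allFin (suc m)) ⟩
      sumL (λ i → ⟦ isLast i ⟧ * excess μ (i , 0)) (allFin (suc m)) + sumOnLast μ σ (excess μ)
        ≡⟨ cong (_+ sumOnLast μ σ (excess μ)) (sumL-allFin-isLast (λ i → excess μ (i , 0))) ⟩
      excess μ (ℓ , 0) + sumOnLast μ σ (excess μ)
        ∎
      where open ≡-Reasoning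

    weightedArmDes-πfill :
      weightedDes (πμ μ) (πfill μ σ) (arm (πμ μ)) + lastExcess μ σ ≡ weightedDes μ σ (arm μ) + notTaller μ
    weightedArmDes-πfill = begin
      WD′ + lastExcess μ σ                              ≡⟨ cong (WD′ +_) lastExcess-split ⟩
      WD′ + (excess μ (ℓ , 0) + sumOnLast μ σ (excess μ)) ≡⟨ exchange-middle WD′ (excess μ (ℓ , 0)) _ ⟩
      excess μ (ℓ , 0) + (WD′ + sumOnLast μ σ (excess μ)) ≡⟨ cong (excess μ (ℓ , 0) +_) telescoped ⟩
      excess μ (ℓ , 0) + (WD + arm μ (ℓ , 1))             ≡⟨ exchange-middle (excess μ (ℓ , 0)) WD _ ⟩
      WD + (excess μ (ℓ , 0) + arm μ (ℓ , 1))             ≡⟨ cong (WD +_) (notTaller-split μ) ⟨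
      WD + notTaller μ                                  ∎
      where
      open ≡-Reasoning
      WD′ WD : ℕ
      WD′ = weightedDes (πμ μ) (πfill μ σ) (arm (πμ μ))
      WD  = weightedDes μ σ (arm μ)
      exchange-middle : ∀ a b c → a + (b + c) ≡ b + (a + c)
      exchange-middle = solve-∀
      telescoped : WD′ + sumOnLast μ σ (excess μ) ≡ WD + arm μ (ℓ , 1)
      telescoped = trans
        (weightedDes-πfill μ σ (arm (πμ μ)) (arm μ) (arm-πbox μ) (excess μ)
          (λ i j sj<μi → arm-step μ i j (<-trans (n<1+n j) sj<μi)) (arm-top μ))
        (cong (WD +_) (bottomWeight-arm μ))

  -- coinv and maj

  coinvPlusInv : ∀ {n} (μ : Fin n → ℕ) → Filling μ → ℕ
  coinvPlusInv μ σ = sumL (arm μ) (dg′ μ) + coTriv μ + weightedDes μ σ (arm μ)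

  coinvPlusInv-πfill : ∀ {m} (μ : Fin (suc m) → ℕ) (σ : Filling μ) → NonAttacking μ σ →
    coinvPlusInv (πμ μ) (πfill μ σ) + invCount μ σ ≡ coinvPlusInv μ σ + invCount (πμ μ) (πfill μ σ)
  coinvPlusInv-πfill {m} μ σ na = +-cancelʳ-≡ (LE + nT) _ _ (begin
    ΣA′ + C′ + SD′ + I + (LE + nT)            ≡⟨ cong (λ x → x + C′ + SD′ + I + (LE + nT)) (sumL-arm-πμ μ) ⟩
    nT + ΣA + C′ + SD′ + I + (LE + nT)        ≡⟨ regroup₁ nT ΣA C′ SD′ I LE ⟩
    ΣA + (C′ + nT) + (SD′ + LE) + I + nT      ≡⟨ cong₂ (λ x y → ΣA + x + y + I + nT) (coTriv-πμ μ) (weightedArmDes-πfill μ σ) ⟩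
    ΣA + (C + t) + (SD + nT) + I + nT         ≡⟨ regroup₂ ΣA C t SD nT I ⟩
    ΣA + C + SD + I + nT + (nT + t)           ≡⟨ cong (ΣA + C + SD + I + nT +_) (notTaller+taller μ) ⟩
    ΣA + C + SD + I + nT + m                  ≡⟨ regroup₃ (ΣA + C + SD) I nT m ⟩
    ΣA + C + SD + (I + m) + nT                ≡⟨ cong (λ x → ΣA + C + SD + x + nT) (invCount-πfill μ σ na) ⟨
    ΣA + C + SD + (I′ + LE) + nT              ≡⟨ regroup₄ (ΣA + C + SD) I′ LE nT ⟩
    ΣA + C + SD + I′ + (LE + nT)              ∎)
    where
    open ≡-Reasoning
    ΣA′ C′ SD′ I′ ΣA C SD I LE nT t : ℕ
    ΣA′ = sumL (arm (πμ μ)) (dg′ (πμ μ))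
    C′  = coTriv (πμ μ)
    SD′ = weightedDes (πμ μ) (πfill μ σ) (arm (πμ μ))
    I′  = invCount (πμ μ) (πfill μ σ)
    ΣA  = sumL (arm μ) (dg′ μ)
    C   = coTriv μ
    SD  = weightedDes μ σ (arm μ)
    I   = invCount μ σ
    LE  = lastExcess μ σ
    nT  = notTaller μ
    t   = taller μ
    regroup₁ : ∀ nT ΣA C′ SD′ I LE → nT + ΣA + C′ + SD′ + I + (LE + nT) ≡ ΣA + (C′ + nT) + (SD′ + LE) + I + nT
    regroup₁ = solve-∀
    regroup₂ : ∀ ΣA C t SD nT I → ΣA + (C + t) + (SD + nT) + I + nT ≡ ΣA + C + SD + I + nT + (nT + t)
    regroup₂ = solve-∀
    regroup₃ : ∀ X I nT m → X + I + nT + m ≡ X + (I + m) + nT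
    regroup₃ = solve-∀
    regroup₄ : ∀ X I′ LE nT → X + (I′ + LE) + nT ≡ X + I′ + (LE + nT)
    regroup₄ = solve-∀

  coinv≡coinvPlusInv-invCount : ∀ {n} (μ : Fin n → ℕ) (σ : Filling μ) →
    coinv μ σ ≡ pos (coinvPlusInv μ σ) -ℤ pos (invCount μ σ)
  coinv≡coinvPlusInv-invCount μ σ = begin
    pos ΣA -ℤ ((pos I -ℤ pos C) -ℤ pos SD)    ≡⟨ rearrange (pos ΣA) (pos C) (pos SD) (pos I) ⟩
    (pos ΣA +ℤ pos C +ℤ pos SD) -ℤ pos I     ≡⟨ cong (_-ℤ pos I) (trans (cong (_+ℤ pos SD) (sym (pos-+ ΣA C))) (sym (pos-+ (ΣA + C) SD))) ⟩
    pos (ΣA + C + SD) -ℤ pos I               ∎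
    where
    open ≡-Reasoning
    ΣA C SD I : ℕ
    ΣA = sumL (arm μ) (dg′ μ)
    C  = coTriv μ
    SD = weightedDes μ σ (arm μ)
    I  = invCount μ σ
    rearrange : ∀ a c s i → a -ℤ ((i -ℤ c) -ℤ s) ≡ (a +ℤ c +ℤ s) -ℤ i
    rearrange = ℤ-Solver.solve-∀

  pos-diff-≡ : ∀ a b c d → a + d ≡ c + b → pos a -ℤ pos b ≡ pos c -ℤ pos d
  pos-diff-≡ a b c d a+d≡c+b = begin
    pos a -ℤ pos b                        ≡⟨ shift (pos a) (pos b) (pos d) ⟩
    (pos a +ℤ pos d) -ℤ (pos b +ℤ pos d)  ≡⟨ cong (_-ℤ (pos b +ℤ pos d)) (trans (sym (pos-+ a d)) (trans (cong pos a+d≡c+b) (pos-+ c b))) ⟩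
    (pos c +ℤ pos b) -ℤ (pos b +ℤ pos d)  ≡⟨ cancel (pos c) (pos b) (pos d) ⟩
    pos c -ℤ pos d                        ∎
    where
    open ≡-Reasoning
    shift : ∀ x y z → x -ℤ y ≡ (x +ℤ z) -ℤ (y +ℤ z)
    shift = ℤ-Solver.solve-∀
    cancel : ∀ x y z → (x +ℤ y) -ℤ (y +ℤ z) ≡ x -ℤ z
    cancel = ℤ-Solver.solve-∀

  pos-≡-diff : ∀ {a b c} → a + b ≡ c → pos a ≡ pos c -ℤ pos b
  pos-≡-diff {a} {b} refl = trans (cancel (pos a) (pos b)) (cong (_-ℤ pos b) (sym (pos-+ a b)))
    where
    cancel : ∀ x y → x ≡ (x +ℤ y) -ℤ y
    cancel = ℤ-Solver.solve-∀

  coinv-πfill : ∀ {m} (μ : Fin (suc m) → ℕ) (σ : Filling μ) → NonAttacking μ σ →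
    coinv (πμ μ) (πfill μ σ) ≡ coinv μ σ
  coinv-πfill μ σ na = begin
    coinv μ′ σ′                                 ≡⟨ coinv≡coinvPlusInv-invCount μ′ σ′ ⟩
    pos (coinvPlusInv μ′ σ′) -ℤ pos (invCount μ′ σ′)
      ≡⟨ pos-diff-≡ (coinvPlusInv μ′ σ′) (invCount μ′ σ′) (coinvPlusInv μ σ) (invCount μ σ) (coinvPlusInv-πfill μ σ na) ⟩
    pos (coinvPlusInv μ σ) -ℤ pos (invCount μ σ) ≡⟨ coinv≡coinvPlusInv-invCount μ σ ⟨
    coinv μ σ                                   ∎
    where
    open ≡-Reasoning
    μ′ = πμ μ
    σ′ = πfill μ σ

  maj-πfill-ℤ : ∀ {m} (μ : Fin (suc m) → ℕ) (σ : Filling μ) →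
    pos (maj (πμ μ) (πfill μ σ)) ≡ (pos (maj μ σ) +ℤ pos (μ (fromℕ m))) -ℤ pos (rCount μ σ)
  maj-πfill-ℤ {m} μ σ = begin
    pos (maj (πμ μ) (πfill μ σ))                              ≡⟨ pos-≡-diff (maj-πfill μ σ) ⟩
    pos (maj μ σ + μ (fromℕ m)) -ℤ pos (rCount μ σ)           ≡⟨ cong (_-ℤ pos (rCount μ σ)) (pos-+ (maj μ σ) _) ⟩
    (pos (maj μ σ) +ℤ pos (μ (fromℕ m))) -ℤ pos (rCount μ σ)  ∎
    where open ≡-Reasoning

open import Data.Nat using (ℕ; suc)
open import Data.Fin using (Fin; fromℕ)
open import Data.Product using (_×_; _,_)
open import Data.Integer using (ℤ; +_; _+_; _-_)
open import Relation.Binary.PropositionalEquality using (_≡_)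

proposition4p2 : (m : ℕ) (μ : Fin (suc m) → ℕ) (σ : Filling μ) →
    NonAttacking μ σ →
    (coinv (πμ μ) (πfill μ σ) ≡ coinv μ σ)
    × (+ maj (πμ μ) (πfill μ σ) ≡ (+ maj μ σ + + μ (fromℕ m)) - + rCount μ σ)
proposition4p2 m μ σ na = coinv-πfill μ σ na , maj-πfill-ℤ μ σ
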